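{- For every positive integer $k$, $$\sum_{n_k \ge n_{k-1} \ge \cdots \ge n_1 \ge 1}\frac{q^{n_1 + n_2 + \cdots + n_k}}{(1-q^{n_k})^2 (1-q^{n_{k-1}})^2 \cdots (1-q^{n_1})^2}=\sum_{n=1}^\infty (-1)^{n-1} q^{n(n-1)/2 + kn} \frac{ (1+q^n) }{ (1-q^n)^{2k} }.$$
   Context: The sum on the left is over integers $n_1,\dots,n_k$ with $n_k\ge\cdots\ge n_1\ge1$; identities are of formal power series in $q$. -}

module Defs where

open import Data.Nat as ℕ using (ℕ; zero; suc; _∸_; _≤_)
open import Data.Nat.Divisibility using (_∣?_)
open import Data.Nat.DivMod using (_/_)
open import Data.Integer as ℤ using (ℤ; 0ℤ; 1ℤ; -_)
open import Data.List using (List; []; _∷_; map; foldr; concatMap; upTo)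
open import Data.Nat.ListAction using (sum)
open import Relation.Nullary.Decidable using (does)
open import Data.Bool using (if_then_else_)

-- Formal power series in q with integer coefficients: N ↦ coefficient of q^N.
FPS : Set
FPS = ℕ → ℤ

𝟘 : FPS
𝟘 _ = 0ℤ

infixl 6 _⊕_
_⊕_ : FPS → FPS → FPS
(f ⊕ g) N = f N ℤ.+ g N

infixl 7 _·_
_·_ : ℤ → FPS → FPS
(c · f) N = c ℤ.* f N

infixl 7 _⊛_
_⊛_ : FPS → FPS → FPS
(f ⊛ g) N = foldr ℤ._+_ 0ℤ (map (λ i → f i ℤ.* g (N ∸ i)) (upTo (suc N)))

qPow : ℕ → FPS
qPow a N = if does (N ℕ.≟ a) then 1ℤ else 0ℤ

𝟙 : FPS
𝟙 = qPow 0

infixr 8 _^_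
_^_ : FPS → ℕ → FPS
f ^ zero  = 𝟙
f ^ suc e = f ⊛ (f ^ e)

-- (1 - q^n)^{-1} = Σ_{j≥0} q^{nj}, for n ≥ 1 (the value at n = 0 is junk
-- and never used: 1 - q^0 = 0 is not invertible).
inv1-q^ : ℕ → FPS
inv1-q^ zero    = 𝟘
inv1-q^ n@(suc _) N = if does (n ∣? N) then 1ℤ else 0ℤ

ΣL : List FPS → FPS
ΣL = foldr _⊕_ 𝟘

-- the integers lo, lo+1, ..., M  (empty if M < lo)
range : ℕ → ℕ → List ℕ
range lo M = map (lo ℕ.+_) (upTo (suc M ∸ lo))

-- weakly increasing lists [n₁, …, n_k] with lo ≤ n₁ ≤ n₂ ≤ ⋯ ≤ n_k ≤ M
chainsFrom : ℕ → ℕ → ℕ → List (List ℕ)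
chainsFrom lo zero    M = [] ∷ []
chainsFrom lo (suc k) M =
  concatMap (λ n → map (n ∷_) (chainsFrom n k M)) (range lo M)

chains : ℕ → ℕ → List (List ℕ)
chains k M = chainsFrom 1 k M

lhsTerm : List ℕ → FPS
lhsTerm ns = qPow (sum ns) ⊛ foldr (λ n acc → (inv1-q^ n ^ 2) ⊛ acc) 𝟙 ns

-- partial sum of the LHS over chains with n_k ≤ M
lhsPartial : ℕ → ℕ → FPS
lhsPartial k M = ΣL (map lhsTerm (chains k M))

rhsTerm : ℕ → ℕ → FPS
rhsTerm k n =
  ((- 1ℤ) ℤ.^ (n ∸ 1)) ·
    (qPow ((n ℕ.* (n ∸ 1)) / 2 ℕ.+ k ℕ.* n) ⊛ (𝟙 ⊕ qPow n) ⊛ (inv1-q^ n ^ (2 ℕ.* k)))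

rhsPartial : ℕ → ℕ → FPS
rhsPartial k M = ΣL (map (rhsTerm k) (range 1 M))

-- Put α n = qⁿ/(1-qⁿ)².  The left-hand side is the complete homogeneous symmetric
-- function h_k of the α n, and the right-hand side is a partial-fraction expansion
-- Σ_n c_n (α n)ᵏ with c_n = (-1)^{n-1} q^{n(n-1)/2} (1+qⁿ).  For a finite set S of
-- nodes, Lagrange interpolation gives h_k(S) = Σ_{n∈S} (α n)ᵏ Π_{m∈S, m≠n} α n/(α n - α m).
-- In ℤ[[q]] the quotient α n/(α n - α m) is an explicit series F n m, and the
-- identity is proved from the recursion of h_k by removing the end points of an
-- interval of nodes.  For S = [1, M] the weight Π_{m≠n} F n m has a closed form
-- which agrees with c_n below degree M - n + 1, and (α n)ᵏ starts in degree n;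
-- so the coefficients of q^N of both partial sums agree as soon as M ≥ 2N.
module Submission where

open import Defs
open import Data.Nat as ℕ using (ℕ; zero; suc; _∸_; _<_; _≤_; z≤n; s≤s)
import Data.Nat.Properties as ℕP
open import Data.Integer as ℤ using (ℤ; 0ℤ; 1ℤ; -_; _+_; _*_)
import Data.Integer.Properties as ℤP
open import Data.Integer.Tactic.RingSolver using (solve-∀)
open import Data.List using (List; []; _∷_; _++_; map; foldr; concatMap; applyUpTo)
open import Data.List.Properties using (map-∘)
open import Data.Nat.ListAction using (sum)
open import Data.Nat.ListAction.Properties using (sum-++)
open import Data.Nat.DivMod using (_/_; m*n/n≡m)
open import Data.Nat.Tactic.RingSolver using () renaming (solve-∀ to ℕ-solve-∀)
open import Data.List.Membership.Propositional using (_∈_)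
open import Data.List.Relation.Unary.Any using (here; there)
open import Data.Maybe using (nothing)
open import Data.Product using (_×_; _,_; proj₁; proj₂; ∃-syntax)
open import Function using (_∘_; id)
open import Level using (0ℓ)
open import Relation.Binary.PropositionalEquality
  using (_≡_; refl; sym; trans; cong; cong₂; subst; module ≡-Reasoning)
open import Relation.Nullary using (Dec; yes; no; does; ¬_)
open import Relation.Nullary.Decidable using (dec-true; dec-false)
open import Data.Bool using (if_then_else_)
open import Data.Empty using (⊥-elim)
open import Relation.Binary.Definitions using (tri<; tri≈; tri>)
open import Data.Nat.Divisibility using (_∣?_; ∣m+n∣m⇒∣n; ∣m∣n⇒∣m+n; ∣-refl; ∣⇒≤)
open import Algebra.Bundles using (CommutativeRing)
import Relation.Binary.Reasoning.Setoid

sumTo : (ℕ → ℤ) → ℕ → ℤ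
sumTo h n = foldr _+_ 0ℤ (applyUpTo h n)

map-applyUpTo : ∀ {A B : Set} (f : A → B) (g : ℕ → A) n →
                map f (applyUpTo g n) ≡ applyUpTo (f ∘ g) n
map-applyUpTo f g zero    = refl
map-applyUpTo f g (suc n) = cong (f (g 0) ∷_) (map-applyUpTo f (g ∘ suc) n)

⊛-coeff : ∀ f g N → (f ⊛ g) N ≡ sumTo (λ i → f i * g (N ∸ i)) (suc N)
⊛-coeff f g N = cong (foldr _+_ 0ℤ) (map-applyUpTo (λ i → f i * g (N ∸ i)) id (suc N))

sumTo-cong< : ∀ {h h'} n → (∀ i → i < n → h i ≡ h' i) → sumTo h n ≡ sumTo h' n
sumTo-cong< zero    e = refl
sumTo-cong< (suc n) e = cong₂ _+_ (e 0 (s≤s z≤n)) (sumTo-cong< n (λ i i<n → e (suc i) (s≤s i<n)))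

sumTo-cong : ∀ {h h'} n → (∀ i → h i ≡ h' i) → sumTo h n ≡ sumTo h' n
sumTo-cong n e = sumTo-cong< n (λ i _ → e i)

sumTo-+ : ∀ h h' n → sumTo (λ i → h i + h' i) n ≡ sumTo h n + sumTo h' n
sumTo-+ h h' zero    = refl
sumTo-+ h h' (suc n) =
  trans (cong (h 0 + h' 0 +_) (sumTo-+ (h ∘ suc) (h' ∘ suc) n)) (swap (h 0) (h' 0) _ _)
  where swap : ∀ a b c d → a + b + (c + d) ≡ a + c + (b + d)
        swap = solve-∀

sumTo-* : ∀ c h n → sumTo (λ i → c * h i) n ≡ c * sumTo h n
sumTo-* c h zero    = sym (ℤP.*-zeroʳ c)
sumTo-* c h (suc n) =
  trans (cong (c * h 0 +_) (sumTo-* c (h ∘ suc) n)) (sym (ℤP.*-distribˡ-+ c (h 0) _))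

sumTo-0 : ∀ n → sumTo (λ _ → 0ℤ) n ≡ 0ℤ
sumTo-0 zero    = refl
sumTo-0 (suc n) = trans (ℤP.+-identityˡ _) (sumTo-0 n)

infix 4 _≈_
record _≈_ (f g : FPS) : Set where
  constructor mk≈
  field at : ∀ N → f N ≡ g N
open _≈_ public

≈-refl : ∀ {f} → f ≈ f
≈-refl = mk≈ λ _ → refl

≈-sym : ∀ {f g} → f ≈ g → g ≈ f
≈-sym e = mk≈ λ N → sym (at e N)

≈-trans : ∀ {f g h} → f ≈ g → g ≈ h → f ≈ h
≈-trans e e' = mk≈ λ N → trans (at e N) (at e' N)

≡⇒≈ : ∀ {f g} → f ≡ g → f ≈ g
≡⇒≈ refl = ≈-refl

⊖_ : FPS → FPS
(⊖ f) N = - f N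

tl : FPS → FPS
tl f = f ∘ suc

⊛-suc : ∀ f g N → (f ⊛ g) (suc N) ≡ f 0 * g (suc N) + (tl f ⊛ g) N
⊛-suc f g N = trans (⊛-coeff f g (suc N)) (cong (f 0 * g (suc N) +_) (sym (⊛-coeff (tl f) g N)))

⊛-zero : ∀ f g → (f ⊛ g) 0 ≡ f 0 * g 0
⊛-zero f g = ℤP.+-identityʳ (f 0 * g 0)

⊛-linear : ∀ f g f' g' h h' → (∀ i j → f i * g j ≡ f' i * g' j + h i * h' j) →
           ∀ N → (f ⊛ g) N ≡ (f' ⊛ g') N + (h ⊛ h') N
⊛-linear f g f' g' h h' e N = begin
  (f ⊛ g) N
    ≡⟨ ⊛-coeff f g N ⟩
  sumTo (λ i → f i * g (N ∸ i)) (suc N)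
    ≡⟨ sumTo-cong (suc N) (λ i → e i (N ∸ i)) ⟩
  sumTo (λ i → f' i * g' (N ∸ i) + h i * h' (N ∸ i)) (suc N)
    ≡⟨ sumTo-+ (λ i → f' i * g' (N ∸ i)) (λ i → h i * h' (N ∸ i)) (suc N) ⟩
  sumTo (λ i → f' i * g' (N ∸ i)) (suc N) + sumTo (λ i → h i * h' (N ∸ i)) (suc N)
    ≡⟨ sym (cong₂ _+_ (⊛-coeff f' g' N) (⊛-coeff h h' N)) ⟩
  (f' ⊛ g') N + (h ⊛ h') N ∎
  where open ≡-Reasoning

⊛-cong : ∀ {f f' g g'} → f ≈ f' → g ≈ g' → f ⊛ g ≈ f' ⊛ g'
⊛-cong {f} {f'} {g} {g'} e e' = mk≈ λ N → trans (⊛-coeff f g N)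
  (trans (sumTo-cong (suc N) (λ i → cong₂ _*_ (at e i) (at e' (N ∸ i)))) (sym (⊛-coeff f' g' N)))

⊛-zeroˡ : ∀ g → 𝟘 ⊛ g ≈ 𝟘
⊛-zeroˡ g = mk≈ λ N → trans (⊛-coeff 𝟘 g N)
  (trans (sumTo-cong (suc N) (λ i → ℤP.*-zeroˡ (g (N ∸ i)))) (sumTo-0 (suc N)))

⊛-distribˡ : ∀ f g h → f ⊛ (g ⊕ h) ≈ f ⊛ g ⊕ f ⊛ h
⊛-distribˡ f g h = mk≈ (⊛-linear f (g ⊕ h) f g f h (λ i j → ℤP.*-distribˡ-+ (f i) (g j) (h j)))

⊛-distribʳ : ∀ f g h → (g ⊕ h) ⊛ f ≈ g ⊛ f ⊕ h ⊛ f
⊛-distribʳ f g h = mk≈ (⊛-linear (g ⊕ h) f g f h f (λ i j → ℤP.*-distribʳ-+ (f j) (g i) (h i)))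

⊛-scalarˡ : ∀ c f g → (c · f) ⊛ g ≈ c · (f ⊛ g)
⊛-scalarˡ c f g = mk≈ λ N → trans (⊛-coeff (c · f) g N) (trans
  (sumTo-cong (suc N) (λ i → ℤP.*-assoc c (f i) (g (N ∸ i))))
  (trans (sumTo-* c (λ i → f i * g (N ∸ i)) (suc N)) (cong (c *_) (sym (⊛-coeff f g N)))))

⊛-identityˡ : ∀ g → 𝟙 ⊛ g ≈ g
⊛-identityˡ g = mk≈ λ where
  zero    → trans (⊛-zero 𝟙 g) (ℤP.*-identityˡ (g 0))
  (suc N) → trans (⊛-suc 𝟙 g N)
              (trans (cong₂ _+_ (ℤP.*-identityˡ (g (suc N))) (at (⊛-zeroˡ g) N)) (ℤP.+-identityʳ _))

⊛-assoc : ∀ f g h → (f ⊛ g) ⊛ h ≈ f ⊛ (g ⊛ h)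
⊛-assoc f g h = mk≈ (go f)
  where
  go : ∀ f N → ((f ⊛ g) ⊛ h) N ≡ (f ⊛ (g ⊛ h)) N
  go f zero = trans (⊛-zero (f ⊛ g) h) (trans (cong (_* h 0) (⊛-zero f g))
                (trans (ℤP.*-assoc (f 0) (g 0) (h 0)) (sym (trans (⊛-zero f (g ⊛ h)) (cong (f 0 *_) (⊛-zero g h))))))
  go f (suc N) = begin
    ((f ⊛ g) ⊛ h) (suc N)
      ≡⟨ ⊛-suc (f ⊛ g) h N ⟩
    (f ⊛ g) 0 * h (suc N) + (tl (f ⊛ g) ⊛ h) N
      ≡⟨ cong₂ _+_ (cong (_* h (suc N)) (⊛-zero f g)) (⊛-linear (tl (f ⊛ g)) h (f 0 · tl g) h (tl f ⊛ g) h
           (λ i j → trans (cong (_* h j) (⊛-suc f g i)) (ℤP.*-distribʳ-+ (h j) (f 0 * g (suc i)) ((tl f ⊛ g) i))) N) ⟩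
    f 0 * g 0 * h (suc N) + (((f 0 · tl g) ⊛ h) N + ((tl f ⊛ g) ⊛ h) N)
      ≡⟨ cong (λ z → f 0 * g 0 * h (suc N) + z) (cong₂ _+_ (at (⊛-scalarˡ (f 0) (tl g) h) N) (go (tl f) N)) ⟩
    f 0 * g 0 * h (suc N) + (f 0 * (tl g ⊛ h) N + (tl f ⊛ (g ⊛ h)) N)
      ≡⟨ regroup (f 0) (g 0) (h (suc N)) _ _ ⟩
    f 0 * (g 0 * h (suc N) + (tl g ⊛ h) N) + (tl f ⊛ (g ⊛ h)) N
      ≡⟨ sym (trans (⊛-suc f (g ⊛ h) N) (cong (λ z → f 0 * z + (tl f ⊛ (g ⊛ h)) N) (⊛-suc g h N))) ⟩
    (f ⊛ (g ⊛ h)) (suc N) ∎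
    where
    open ≡-Reasoning
    regroup : ∀ a b c x y → a * b * c + (a * x + y) ≡ a * (b * c + x) + y
    regroup = solve-∀

-- Commutativity, peeling off the first coefficient of both factors at once.
⊛-comm : ∀ f g → f ⊛ g ≈ g ⊛ f
⊛-comm f g = mk≈ (go f g)
  where
  go : ∀ f g N → (f ⊛ g) N ≡ (g ⊛ f) N
  go f g zero = trans (⊛-zero f g) (trans (ℤP.*-comm (f 0) (g 0)) (sym (⊛-zero g f)))
  go f g (suc zero) = begin
    (f ⊛ g) 1               ≡⟨ trans (⊛-suc f g 0) (cong (f 0 * g 1 +_) (⊛-zero (tl f) g)) ⟩
    f 0 * g 1 + f 1 * g 0   ≡⟨ swap (f 0) (g 1) (f 1) (g 0) ⟩
    g 0 * f 1 + g 1 * f 0   ≡⟨ sym (trans (⊛-suc g f 0) (cong (g 0 * f 1 +_) (⊛-zero (tl g) f))) ⟩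
    (g ⊛ f) 1               ∎
    where
    open ≡-Reasoning
    swap : ∀ a b c d → a * b + c * d ≡ d * c + b * a
    swap = solve-∀
  go f g (suc (suc N)) = begin
    (f ⊛ g) (2 ℕ.+ N)
      ≡⟨ ⊛-suc f g (suc N) ⟩
    f 0 * g (2 ℕ.+ N) + (tl f ⊛ g) (suc N)
      ≡⟨ cong (f 0 * g (2 ℕ.+ N) +_) (trans (go (tl f) g (suc N)) (⊛-suc g (tl f) N)) ⟩
    f 0 * g (2 ℕ.+ N) + (g 0 * f (2 ℕ.+ N) + (tl g ⊛ tl f) N)
      ≡⟨ cong (λ z → f 0 * g (2 ℕ.+ N) + (g 0 * f (2 ℕ.+ N) + z)) (go (tl g) (tl f) N) ⟩
    f 0 * g (2 ℕ.+ N) + (g 0 * f (2 ℕ.+ N) + (tl f ⊛ tl g) N)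
      ≡⟨ exchange (f 0 * g (2 ℕ.+ N)) (g 0 * f (2 ℕ.+ N)) ((tl f ⊛ tl g) N) ⟩
    g 0 * f (2 ℕ.+ N) + (f 0 * g (2 ℕ.+ N) + (tl f ⊛ tl g) N)
      ≡⟨ cong (g 0 * f (2 ℕ.+ N) +_) (sym (trans (go (tl g) f (suc N)) (⊛-suc f (tl g) N))) ⟩
    g 0 * f (2 ℕ.+ N) + (tl g ⊛ f) (suc N)
      ≡⟨ sym (⊛-suc g f (suc N)) ⟩
    (g ⊛ f) (2 ℕ.+ N) ∎
    where
    open ≡-Reasoning
    exchange : ∀ a b c → a + (b + c) ≡ b + (a + c)
    exchange = solve-∀

⊛-identityʳ : ∀ g → g ⊛ 𝟙 ≈ g
⊛-identityʳ g = ≈-trans (⊛-comm g 𝟙) (⊛-identityˡ g)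

-- Congruences, with the unchanged argument explicit (⊛ and ⊕ are not injective).
⊛-congˡ : ∀ f {g g'} → g ≈ g' → f ⊛ g ≈ f ⊛ g'
⊛-congˡ f e = ⊛-cong (≈-refl {f}) e

⊛-congʳ : ∀ h {g g'} → g ≈ g' → g ⊛ h ≈ g' ⊛ h
⊛-congʳ h e = ⊛-cong e (≈-refl {h})

⊕-cong : ∀ {f f' g g'} → f ≈ f' → g ≈ g' → f ⊕ g ≈ f' ⊕ g'
⊕-cong e e' = mk≈ λ N → cong₂ _+_ (at e N) (at e' N)

⊕-congˡ : ∀ f {g g'} → g ≈ g' → f ⊕ g ≈ f ⊕ g'
⊕-congˡ f e = ⊕-cong (≈-refl {f}) e

⊕-congʳ : ∀ h {g g'} → g ≈ g' → g ⊕ h ≈ g' ⊕ h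
⊕-congʳ h e = ⊕-cong e (≈-refl {h})

⊖-cong : ∀ {f f'} → f ≈ f' → ⊖ f ≈ ⊖ f'
⊖-cong e = mk≈ λ N → cong -_ (at e N)

FPS-commutativeRing : CommutativeRing 0ℓ 0ℓ
FPS-commutativeRing = record
  { Carrier = FPS ; _≈_ = _≈_ ; _+_ = _⊕_ ; _*_ = _⊛_ ; -_ = ⊖_ ; 0# = 𝟘 ; 1# = 𝟙
  ; isCommutativeRing = record
    { isRing = record
      { +-isAbelianGroup = record
        { isGroup = record
          { isMonoid = record
            { isSemigroup = record
              { isMagma = record
                { isEquivalence = record { refl = ≈-refl ; sym = ≈-sym ; trans = ≈-trans }
                ; ∙-cong = ⊕-cong }
              ; assoc = λ f g h → mk≈ λ N → ℤP.+-assoc (f N) (g N) (h N) }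
            ; identity = (λ f → mk≈ λ N → ℤP.+-identityˡ (f N)) , (λ f → mk≈ λ N → ℤP.+-identityʳ (f N)) }
          ; inverse = (λ f → mk≈ λ N → ℤP.+-inverseˡ (f N)) , (λ f → mk≈ λ N → ℤP.+-inverseʳ (f N))
          ; ⁻¹-cong = ⊖-cong }
        ; comm = λ f g → mk≈ λ N → ℤP.+-comm (f N) (g N) }
      ; *-cong = ⊛-cong
      ; *-assoc = ⊛-assoc
      ; *-identity = ⊛-identityˡ , ⊛-identityʳ
      ; distrib = ⊛-distribˡ , ⊛-distribʳ }
    ; *-comm = ⊛-comm } }

open CommutativeRing FPS-commutativeRing public using (setoid; zeroʳ)

-- The constant series c.  Written like qPow so that constant 1ℤ is 𝟙 on the nose.
constant : ℤ → FPS
constant c N = if does (N ℕ.≟ 0) then c else 0ℤ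

constant-0 : constant 0ℤ ≈ 𝟘
constant-0 = mk≈ λ { zero → refl ; (suc N) → refl }

constant-⊛ : ∀ c f → constant c ⊛ f ≈ c · f
constant-⊛ c f = mk≈ λ where
  zero    → ⊛-zero (constant c) f
  (suc N) → trans (⊛-suc (constant c) f N)
              (trans (cong (c * f (suc N) +_) (at (⊛-zeroˡ f) N)) (ℤP.+-identityʳ _))

constant-* : ∀ a b → constant (a * b) ≈ constant a ⊛ constant b
constant-* a b = ≈-sym (≈-trans (constant-⊛ a (constant b)) (mk≈ λ { zero → refl ; (suc N) → ℤP.*-zeroʳ a }))

-- The library's
-- NonReflective solver takes the ring itself as coefficient ring, which would
-- leave cancellations such as 1 - 1 undecided; here the same sparse-polynomial
-- normaliser is instantiated with coefficients in ℤ, embedded by constant.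
module FPS-Solver where
  open import Tactic.RingSolver.Core.AlmostCommutativeRing as ACR using (AlmostCommutativeRing)
  open import Tactic.RingSolver.Core.Polynomial.Parameters using (Homomorphism)
  open import Tactic.RingSolver.Core.Expression public
    using (Expr; Ι; module Eval)
    renaming (Κ to con; _⊕_ to _:+_; _⊗_ to _:*_; ⊝_ to :-_; _⊛_ to _:^_)
  open import Data.Vec using (Vec)
  open import Relation.Nullary.Decidable using (isYes; toWitness)

  -- (the zero test of ring elements is only used by the library's own solvers)
  FPS-ring : AlmostCommutativeRing 0ℓ 0ℓ
  FPS-ring = ACR.fromCommutativeRing FPS-commutativeRing (λ _ → nothing)

  open AlmostCommutativeRing FPS-ring using (semiring; -‿cong; +-cong; *-cong)
  open import Algebra.Properties.Semiring.Exp.TCOptimised semiring using (^-congˡ)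

  constant-homomorphism : Homomorphism 0ℓ 0ℓ 0ℓ 0ℓ
  constant-homomorphism = record
    { from = record { rawRing = ℤ.+-*-rawRing ; isZero = λ c → isYes (c ℤ.≟ 0ℤ) }
    ; to = FPS-ring
    ; morphism = record
      { ⟦_⟧    = constant
      ; +-homo = λ a b → mk≈ λ { zero → refl ; (suc N) → refl }
      ; *-homo = constant-*
      ; -‿homo = λ a → mk≈ λ { zero → refl ; (suc N) → refl }
      ; 0-homo = constant-0
      ; 1-homo = ≈-refl }
    ; Zero-C⟶Zero-R = λ c c≡0 → ≈-trans (≈-sym constant-0) (≡⇒≈ (cong constant (sym (toWitness {a? = c ℤ.≟ 0ℤ} c≡0))))
    }

  open Eval (AlmostCommutativeRing.rawRing FPS-ring) constant public
  open import Tactic.RingSolver.Core.Polynomial.Base (Homomorphism.from constant-homomorphism)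
  open import Tactic.RingSolver.Core.Polynomial.Semantics constant-homomorphism renaming (⟦_⟧ to ⟦_⟧ₚ)
  open import Tactic.RingSolver.Core.Polynomial.Homomorphism constant-homomorphism

  normalise : ∀ {n} → Expr ℤ n → Poly n
  normalise (con c)  = κ c
  normalise (Ι x)    = ι x
  normalise (x :+ y) = normalise x ⊞ normalise y
  normalise (x :* y) = normalise x ⊠ normalise y
  normalise (:- x)   = ⊟ normalise x
  normalise (x :^ i) = normalise x ⊡ i

  ⟦_⇓⟧ : ∀ {n} → Expr ℤ n → Vec FPS n → FPS
  ⟦ e ⇓⟧ = ⟦ normalise e ⟧ₚ

  correct : ∀ {n} (e : Expr ℤ n) ρ → ⟦ e ⇓⟧ ρ ≈ ⟦ e ⟧ ρ
  correct (con c)  ρ = κ-hom c ρ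
  correct (Ι x)    ρ = ι-hom x ρ
  correct (x :+ y) ρ = ≈-trans (⊞-hom (normalise x) (normalise y) ρ) (+-cong (correct x ρ) (correct y ρ))
  correct (x :* y) ρ = ≈-trans (⊠-hom (normalise x) (normalise y) ρ) (*-cong (correct x ρ) (correct y ρ))
  correct (:- x)   ρ = ≈-trans (⊟-hom (normalise x) ρ) (-‿cong (correct x ρ))
  correct (x :^ i) ρ = ≈-trans (⊡-hom (normalise x) i ρ) (^-congˡ i (correct x ρ))

  open import Relation.Binary.Reflection setoid Ι ⟦_⟧ ⟦_⇓⟧ correct public using (solve)

open FPS-Solver using (solve; Expr; con; _:+_; _:*_; :-_)

infixl 6 _:-_
_:-_ : ∀ {n} → Expr ℤ n → Expr ℤ n → Expr ℤ n
x :- y = x :+ :- y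

infix 4 _:=_
_:=_ : ∀ {n} → Expr ℤ n → Expr ℤ n → Expr ℤ n × Expr ℤ n
_:=_ = _,_

module ≈-Reasoning = Relation.Binary.Reasoning.Setoid setoid

≈⇒difference-zero : ∀ {f g} → f ≈ g → f ⊕ ⊖ g ≈ 𝟘
≈⇒difference-zero {f} {g} f≈g = mk≈ λ N → trans (cong (_+ - g N) (at f≈g N)) (ℤP.+-inverseʳ (g N))

difference-zero⇒≈ : ∀ {f g} → f ⊕ ⊖ g ≈ 𝟘 → f ≈ g
difference-zero⇒≈ {f} {g} f-g≈0 = mk≈ λ N →
  trans (regroup (f N) (g N)) (trans (cong (_+ g N) (at f-g≈0 N)) (ℤP.+-identityˡ (g N)))
  where regroup : ∀ a b → a ≡ a + - b + b
        regroup = solve-∀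

times-1 : ∀ p {e} → e ≈ 𝟙 → p ⊛ e ≈ p
times-1 p e≈1 = ≈-trans (⊛-congˡ p e≈1) (⊛-identityʳ p)

square-1 : ∀ {e} → e ≈ 𝟙 → e ⊛ e ≈ 𝟙
square-1 e≈1 = ≈-trans (⊛-cong e≈1 e≈1) (⊛-identityˡ 𝟙)

drop-unit-factors : ∀ p {a b c} → a ≈ 𝟙 → b ≈ 𝟙 → c ≈ 𝟙 → p ⊛ (a ⊛ a) ⊛ b ⊛ c ≈ p
drop-unit-factors p a≈1 b≈1 c≈1 = ≈-trans (⊛-cong (⊛-cong (times-1 p (square-1 a≈1)) b≈1) c≈1)
  (≈-trans (⊛-identityʳ (p ⊛ 𝟙)) (⊛-identityʳ p))

qPow-off : ∀ a N → ¬ N ≡ a → qPow a N ≡ 0ℤ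
qPow-off a N N≢a = cong (λ b → if b then 1ℤ else 0ℤ) (dec-false (N ℕ.≟ a) N≢a)

qPow-suc-⊛ : ∀ a f N → (qPow (suc a) ⊛ f) (suc N) ≡ (qPow a ⊛ f) N
qPow-suc-⊛ a f N = trans (⊛-suc (qPow (suc a)) f N)
  (trans (cong (_+ (tl (qPow (suc a)) ⊛ f) N) (ℤP.*-zeroˡ (f (suc N)))) (ℤP.+-identityˡ _))

qPow-⊛-below : ∀ a f N → N < a → (qPow a ⊛ f) N ≡ 0ℤ
qPow-⊛-below (suc a) f zero    _       = trans (⊛-zero (qPow (suc a)) f) (ℤP.*-zeroˡ (f 0))
qPow-⊛-below (suc a) f (suc N) (s≤s p) = trans (qPow-suc-⊛ a f N) (qPow-⊛-below a f N p)

qPow-⊛-shift : ∀ a f N → (qPow a ⊛ f) (a ℕ.+ N) ≡ f N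
qPow-⊛-shift zero    f N = at (⊛-identityˡ f) N
qPow-⊛-shift (suc a) f N = trans (qPow-suc-⊛ a f (a ℕ.+ N)) (qPow-⊛-shift a f N)

qPow-+ : ∀ a b → qPow a ⊛ qPow b ≈ qPow (a ℕ.+ b)
qPow-+ zero    b = ⊛-identityˡ (qPow b)
qPow-+ (suc a) b = mk≈ λ where
  zero    → qPow-⊛-below (suc a) (qPow b) 0 (s≤s z≤n)
  (suc N) → trans (qPow-suc-⊛ a (qPow b) N) (at (qPow-+ a b) N)

qPow-split : ∀ a b {c} → a ℕ.+ b ≡ c → qPow c ≈ qPow a ⊛ qPow b
qPow-split a b refl = ≈-sym (qPow-+ a b)

qPow-cancel : ∀ s f → qPow s ⊛ f ≈ 𝟘 → f ≈ 𝟘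
qPow-cancel s f e = mk≈ λ N → trans (sym (qPow-⊛-shift s f N)) (at e (s ℕ.+ N))

qPow-cong : ∀ {a b} → a ≡ b → qPow a ≈ qPow b
qPow-cong refl = ≈-refl

E : ℕ → FPS
E n = 𝟙 ⊕ ⊖ qPow n

I : ℕ → FPS
I = inv1-q^

does-⇔ : ∀ {P Q : Set} (p : Dec P) (q : Dec Q) → (P → Q) → (Q → P) → does p ≡ does q
does-⇔ (yes p) q P→Q Q→P = sym (dec-true q (P→Q p))
does-⇔ (no ¬p) q P→Q Q→P = sym (dec-false q (λ x → ¬p (Q→P x)))

I-periodic : ∀ n N → I (suc n) (suc n ℕ.+ N) ≡ I (suc n) N
I-periodic n N = cong (λ b → if b then 1ℤ else 0ℤ)
  (does-⇔ (suc n ∣? (suc n ℕ.+ N)) (suc n ∣? N) (λ d → ∣m+n∣m⇒∣n d ∣-refl) (∣m∣n⇒∣m+n ∣-refl))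

I-below : ∀ n N → N < suc n → I (suc n) N ≡ 𝟙 N
I-below n zero    _   = refl
I-below n (suc N) N<n =
  cong (λ b → if b then 1ℤ else 0ℤ) (dec-false (suc n ∣? suc N) (λ n∣N → ℕP.<⇒≱ N<n (∣⇒≤ n∣N)))

-- (1 - qⁿ) · Σⱼ q^{nj} = 1: below degree n only j = 0 contributes, above it the
-- geometric series telescopes.
E-I : ∀ n → 1 ≤ n → E n ⊛ I n ≈ 𝟙
E-I (suc p) _ = mk≈ λ N → trans (at expand N) (telescope N)
  where
  n : ℕ
  n = suc p
  expand : E n ⊛ I n ≈ I n ⊕ ⊖ (qPow n ⊛ I n)
  expand = solve 2 (λ x i → (con 1ℤ :- x) :* i := i :- x :* i) ≈-refl (qPow n) (I n)
  telescope : ∀ N → (I n ⊕ ⊖ (qPow n ⊛ I n)) N ≡ 𝟙 N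
  telescope N with N ℕP.<? n
  ... | yes N<n = trans (cong₂ _+_ (I-below p N N<n) (cong -_ (qPow-⊛-below n (I n) N N<n))) (ℤP.+-identityʳ _)
  ... | no N≮n  = subst (λ M → (I n ⊕ ⊖ (qPow n ⊛ I n)) M ≡ 𝟙 M) (ℕP.m+[n∸m]≡n (ℕP.≮⇒≥ N≮n))
      (trans (cong₂ _+_ (I-periodic p (N ∸ n)) (cong -_ (qPow-⊛-shift n (I n) (N ∸ n))))
             (ℤP.+-inverseʳ (I n (N ∸ n))))

-- (1 - b)/(1 - qᵃ) = 1 whenever b = qᵃ, e.g. qᵃ written as a product of monomials.
E-I-at : ∀ {a b} → 1 ≤ a → qPow a ≈ b → (𝟙 ⊕ ⊖ b) ⊛ I a ≈ 𝟙
E-I-at {a} 1≤a qᵃ≈b = ≈-trans (⊛-congʳ (I a) (⊕-congˡ 𝟙 (⊖-cong (≈-sym qᵃ≈b)))) (E-I a 1≤a)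

infix 4 _≈[_]_
_≈[_]_ : FPS → ℕ → FPS → Set
f ≈[ d ] g = ∀ N → N < d → f N ≡ g N

≈⇒≈[] : ∀ {f g} d → f ≈ g → f ≈[ d ] g
≈⇒≈[] d e N _ = at e N

≈[]-sym : ∀ {f g} d → f ≈[ d ] g → g ≈[ d ] f
≈[]-sym d e N N<d = sym (e N N<d)

≈[]-trans : ∀ {f g h} d → f ≈[ d ] g → g ≈[ d ] h → f ≈[ d ] h
≈[]-trans d e e' N N<d = trans (e N N<d) (e' N N<d)

≈[]-mono : ∀ {f g} {d d'} → d ≤ d' → f ≈[ d' ] g → f ≈[ d ] g
≈[]-mono d≤d' e N N<d = e N (ℕP.<-≤-trans N<d d≤d')

≈[]-⊛ : ∀ {f g} d h → f ≈[ d ] g → f ⊛ h ≈[ d ] g ⊛ h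
≈[]-⊛ {f} {g} d h e N N<d = trans (⊛-coeff f h N) (trans
  (sumTo-cong< (suc N) (λ i i≤N → cong (_* h (N ∸ i)) (e i (ℕP.<-≤-trans i≤N N<d))))
  (sym (⊛-coeff g h N)))

≈[]-unit : ∀ d x u → u ≈[ d ] 𝟙 → x ⊛ u ≈[ d ] x
≈[]-unit d x u e = ≈[]-trans d (≈⇒≈[] d (⊛-comm x u))
  (≈[]-trans d (≈[]-⊛ d x e) (≈⇒≈[] d (⊛-identityˡ x)))

E-≈[] : ∀ m → E m ≈[ m ] 𝟙
E-≈[] m N N<m = trans (cong (λ c → 𝟙 N + - c) (qPow-off m N (λ N≡m → ℕP.<-irrefl N≡m N<m)))
                      (ℤP.+-identityʳ (𝟙 N))

interval : ℕ → ℕ → List ℕ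
interval lo zero    = []
interval lo (suc L) = lo ∷ interval (suc lo) L

interval-shift : ∀ a lo L → map (a ℕ.+_) (interval lo L) ≡ interval (a ℕ.+ lo) L
interval-shift a lo zero    = refl
interval-shift a lo (suc L) =
  cong (a ℕ.+ lo ∷_) (trans (interval-shift a (suc lo) L) (cong (λ b → interval b L) (ℕP.+-suc a lo)))

applyUpTo-cong : ∀ {A : Set} {f g : ℕ → A} L → (∀ i → f i ≡ g i) → applyUpTo f L ≡ applyUpTo g L
applyUpTo-cong zero    e = refl
applyUpTo-cong (suc L) e = cong₂ _∷_ (e 0) (applyUpTo-cong L (e ∘ suc))

applyUpTo-interval : ∀ lo L → applyUpTo (lo ℕ.+_) L ≡ interval lo L
applyUpTo-interval lo zero    = refl
applyUpTo-interval lo (suc L) = cong₂ _∷_ (ℕP.+-identityʳ lo)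
  (trans (applyUpTo-cong L (ℕP.+-suc lo)) (applyUpTo-interval (suc lo) L))

range-interval : ∀ lo M → range lo M ≡ interval lo (suc M ∸ lo)
range-interval lo M = trans (map-applyUpTo (lo ℕ.+_) id (suc M ∸ lo)) (applyUpTo-interval lo (suc M ∸ lo))

interval-snoc : ∀ lo L → interval lo (suc L) ≡ interval lo L ++ (lo ℕ.+ L) ∷ []
interval-snoc lo zero    = cong (_∷ []) (sym (ℕP.+-identityʳ lo))
interval-snoc lo (suc L) =
  cong (lo ∷_) (trans (interval-snoc (suc lo) L) (cong (λ b → interval (suc lo) L ++ b ∷ []) (sym (ℕP.+-suc lo L))))

∈-interval : ∀ {n} lo L → n ∈ interval lo L → lo ≤ n × n < lo ℕ.+ L
∈-interval lo (suc L) (here refl) = ℕP.≤-refl , ℕP.m<m+n lo (s≤s z≤n)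
∈-interval {n} lo (suc L) (there n∈) with ∈-interval (suc lo) L n∈
... | lo<n , n<lo+L = ℕP.<⇒≤ lo<n , subst (n <_) (sym (ℕP.+-suc lo L)) n<lo+L

ΠL : List FPS → FPS
ΠL = foldr _⊛_ 𝟙

module _ {A : Set} where

  ΣL-++ : ∀ (g : A → FPS) xs ys → ΣL (map g (xs ++ ys)) ≈ ΣL (map g xs) ⊕ ΣL (map g ys)
  ΣL-++ g []       ys = mk≈ λ N → sym (ℤP.+-identityˡ _)
  ΣL-++ g (x ∷ xs) ys = mk≈ λ N →
    trans (cong (g x N +_) (at (ΣL-++ g xs ys) N)) (sym (ℤP.+-assoc (g x N) _ _))

  ΠL-++ : ∀ (g : A → FPS) xs ys → ΠL (map g (xs ++ ys)) ≈ ΠL (map g xs) ⊛ ΠL (map g ys)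
  ΠL-++ g []       ys = ≈-sym (⊛-identityˡ _)
  ΠL-++ g (x ∷ xs) ys = ≈-trans (⊛-congˡ (g x) (ΠL-++ g xs ys)) (≈-sym (⊛-assoc (g x) _ _))

  ΣL-cong : ∀ {g g' : A → FPS} xs → (∀ {x} → x ∈ xs → g x ≈ g' x) → ΣL (map g xs) ≈ ΣL (map g' xs)
  ΣL-cong []       e = ≈-refl
  ΣL-cong (x ∷ xs) e = ⊕-cong (e (here refl)) (ΣL-cong xs (e ∘ there))

  ΠL-cong : ∀ {g g' : A → FPS} xs → (∀ {x} → x ∈ xs → g x ≈ g' x) → ΠL (map g xs) ≈ ΠL (map g' xs)
  ΠL-cong []       e = ≈-refl
  ΠL-cong (x ∷ xs) e = ⊛-cong (e (here refl)) (ΠL-cong xs (e ∘ there))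

  ΣL-coeff-cong : ∀ {g g' : A → FPS} xs N → (∀ {x} → x ∈ xs → g x N ≡ g' x N) →
                  ΣL (map g xs) N ≡ ΣL (map g' xs) N
  ΣL-coeff-cong []       N e = refl
  ΣL-coeff-cong (x ∷ xs) N e = cong₂ _+_ (e (here refl)) (ΣL-coeff-cong xs N (e ∘ there))

  ΣL-⊕ : ∀ (g h : A → FPS) xs → ΣL (map (λ x → g x ⊕ h x) xs) ≈ ΣL (map g xs) ⊕ ΣL (map h xs)
  ΣL-⊕ g h []       = mk≈ λ _ → refl
  ΣL-⊕ g h (x ∷ xs) = ≈-trans (⊕-congˡ (g x ⊕ h x) (ΣL-⊕ g h xs))
    (solve 4 (λ a b c d → (a :+ b) :+ (c :+ d) := (a :+ c) :+ (b :+ d)) ≈-refl (g x) (h x) _ _)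

  ΣL-⊛ : ∀ c (g : A → FPS) xs → c ⊛ ΣL (map g xs) ≈ ΣL (map (λ x → c ⊛ g x) xs)
  ΣL-⊛ c g []       = zeroʳ c
  ΣL-⊛ c g (x ∷ xs) = ≈-trans (⊛-distribˡ c (g x) _) (⊕-congˡ (c ⊛ g x) (ΣL-⊛ c g xs))

  ΠL-⊛ : ∀ (g h : A → FPS) xs → ΠL (map (λ x → g x ⊛ h x) xs) ≈ ΠL (map g xs) ⊛ ΠL (map h xs)
  ΠL-⊛ g h []       = ≈-sym (⊛-identityˡ 𝟙)
  ΠL-⊛ g h (x ∷ xs) = ≈-trans (⊛-congˡ (g x ⊛ h x) (ΠL-⊛ g h xs))
    (solve 4 (λ a b c d → (a :* b) :* (c :* d) := (a :* c) :* (b :* d)) ≈-refl (g x) (h x) _ _)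

ΠL-snoc : ∀ (g : ℕ → FPS) lo L → ΠL (map g (interval lo (suc L))) ≈ ΠL (map g (interval lo L)) ⊛ g (lo ℕ.+ L)
ΠL-snoc g lo L = ≈-trans (≡⇒≈ (cong (ΠL ∘ map g) (interval-snoc lo L)))
  (≈-trans (ΠL-++ g (interval lo L) ((lo ℕ.+ L) ∷ []))
           (⊛-congˡ (ΠL (map g (interval lo L))) (⊛-identityʳ (g (lo ℕ.+ L)))))

ΣL-snoc : ∀ (g : ℕ → FPS) lo L → ΣL (map g (interval lo (suc L))) ≈ ΣL (map g (interval lo L)) ⊕ g (lo ℕ.+ L)
ΣL-snoc g lo L = ≈-trans (≡⇒≈ (cong (ΣL ∘ map g) (interval-snoc lo L)))
  (≈-trans (ΣL-++ g (interval lo L) ((lo ℕ.+ L) ∷ []))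
           (⊕-congˡ (ΣL (map g (interval lo L))) (mk≈ λ N → ℤP.+-identityʳ (g (lo ℕ.+ L) N))))

module _ {A : Set} where

  ΣL-rotate : ∀ (g : A → FPS) xs x → ΣL (map g (xs ++ x ∷ [])) ≈ ΣL (map g (x ∷ xs))
  ΣL-rotate g xs x = ≈-trans (ΣL-++ g xs (x ∷ [])) (mk≈ λ N → swap (ΣL (map g xs) N) (g x N))
    where swap : ∀ a b → a + (b + 0ℤ) ≡ b + a
          swap = solve-∀

  ΠL-rotate : ∀ (g : A → FPS) xs x → ΠL (map g (xs ++ x ∷ [])) ≈ ΠL (map g (x ∷ xs))
  ΠL-rotate g xs x = ≈-trans (ΠL-++ g xs (x ∷ []))
    (≈-trans (⊛-congˡ (ΠL (map g xs)) (⊛-identityʳ (g x))) (⊛-comm (ΠL (map g xs)) (g x)))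

α : ℕ → FPS
α n = qPow n ⊛ (I n ⊛ I n)

α-shape-difference : ∀ x y u v → (𝟙 ⊕ ⊖ x) ⊛ u ≈ 𝟙 → (𝟙 ⊕ ⊖ y) ⊛ v ≈ 𝟙 →
  x ⊛ (u ⊛ u) ⊕ ⊖ (y ⊛ (v ⊛ v)) ≈ (x ⊕ ⊖ y) ⊛ (𝟙 ⊕ ⊖ (x ⊛ y)) ⊛ (u ⊛ u) ⊛ (v ⊛ v)
α-shape-difference x y u v xu yv = begin
  x ⊛ (u ⊛ u) ⊕ ⊖ (y ⊛ (v ⊛ v))
    ≈⟨ ⊕-cong (≈-sym (times-1 (x ⊛ (u ⊛ u)) (square-1 yv))) (⊖-cong (≈-sym (times-1 (y ⊛ (v ⊛ v)) (square-1 xu)))) ⟩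
  x ⊛ (u ⊛ u) ⊛ (((𝟙 ⊕ ⊖ y) ⊛ v) ⊛ ((𝟙 ⊕ ⊖ y) ⊛ v)) ⊕ ⊖ (y ⊛ (v ⊛ v) ⊛ (((𝟙 ⊕ ⊖ x) ⊛ u) ⊛ ((𝟙 ⊕ ⊖ x) ⊛ u)))
    ≈⟨ solve 4 (λ x y u v →
         x :* (u :* u) :* (((con 1ℤ :- y) :* v) :* ((con 1ℤ :- y) :* v))
           :- y :* (v :* v) :* (((con 1ℤ :- x) :* u) :* ((con 1ℤ :- x) :* u))
         := (x :- y) :* (con 1ℤ :- x :* y) :* (u :* u) :* (v :* v)) ≈-refl x y u v ⟩
  (x ⊕ ⊖ y) ⊛ (𝟙 ⊕ ⊖ (x ⊛ y)) ⊛ (u ⊛ u) ⊛ (v ⊛ v) ∎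
  where open ≈-Reasoning

-- The quotient α n / (α n - α m), as an explicit series.
F : ℕ → ℕ → FPS
F n m = if does (m ℕ.<? n) then ⊖ (qPow (n ∸ m) ⊛ E m ⊛ E m ⊛ I (n ∸ m) ⊛ I (n ℕ.+ m))
        else if does (n ℕ.<? m) then E m ⊛ E m ⊛ I (m ∸ n) ⊛ I (m ℕ.+ n)
        else 𝟙

F-above : ∀ n m → n < m → F n m ≡ E m ⊛ E m ⊛ I (m ∸ n) ⊛ I (m ℕ.+ n)
F-above n m n<m rewrite dec-false (m ℕ.<? n) (ℕP.<⇒≯ n<m) | dec-true (n ℕ.<? m) n<m = refl

F-below : ∀ n m → m < n → F n m ≡ ⊖ (qPow (n ∸ m) ⊛ E m ⊛ E m ⊛ I (n ∸ m) ⊛ I (n ℕ.+ m))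
F-below n m m<n rewrite dec-true (m ℕ.<? n) m<n = refl

F-diag : ∀ n → F n n ≡ 𝟙
F-diag n rewrite dec-false (n ℕ.<? n) (ℕP.<-irrefl refl) = refl

-- F n m ⊛ (α n - α m) = α n when n < m.  With x = qⁿ, z = q^{m-n} the claim is
-- (1-xz)²/((1-z)(1-x²z)) · (x/(1-x)² - xz/(1-xz)²) = x/(1-x)².
F-quotient-above : ∀ n m → 1 ≤ n → n < m → F n m ⊛ (α n ⊕ ⊖ α m) ≈ α n
F-quotient-above n m 1≤n n<m = begin
  F n m ⊛ (α n ⊕ ⊖ α m)
    ≈⟨ ⊛-cong (≡⇒≈ (F-above n m n<m)) (⊕-congˡ (α n) (⊖-cong (⊛-congʳ (v ⊛ v) qᵐ≈xz))) ⟩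
  E m ⊛ E m ⊛ w ⊛ t ⊛ (x ⊛ (u ⊛ u) ⊕ ⊖ ((x ⊛ z) ⊛ (v ⊛ v)))
    ≈⟨ ⊛-cong (⊛-congʳ t (⊛-congʳ w (⊛-cong Eₘ Eₘ))) (α-shape-difference x (x ⊛ z) u v (E-I n 1≤n) xzv) ⟩
  A ⊛ A ⊛ w ⊛ t ⊛ ((x ⊕ ⊖ (x ⊛ z)) ⊛ (𝟙 ⊕ ⊖ (x ⊛ (x ⊛ z))) ⊛ (u ⊛ u) ⊛ (v ⊛ v))
    ≈⟨ ⊛-congˡ (A ⊛ A ⊛ w ⊛ t) (⊛-congʳ (v ⊛ v) (⊛-congʳ (u ⊛ u) (⊛-cong x-xz C-assoc))) ⟩
  A ⊛ A ⊛ w ⊛ t ⊛ (x ⊛ B ⊛ C ⊛ (u ⊛ u) ⊛ (v ⊛ v))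
    ≈⟨ solve 8 (λ x A B C u v w t →
         A :* A :* w :* t :* (x :* B :* C :* (u :* u) :* (v :* v))
         := x :* (u :* u) :* ((A :* v) :* (A :* v)) :* (B :* w) :* (C :* t)) ≈-refl x A B C u v w t ⟩
  x ⊛ (u ⊛ u) ⊛ ((A ⊛ v) ⊛ (A ⊛ v)) ⊛ (B ⊛ w) ⊛ (C ⊛ t)
    ≈⟨ drop-unit-factors (x ⊛ (u ⊛ u)) xzv (E-I d (ℕP.m<n⇒0<n∸m n<m)) (E-I-at 1≤m+n qᵐ⁺ⁿ≈xxz) ⟩
  α n ∎
  where
  open ≈-Reasoning
  d : ℕ
  x z u v w t : FPS
  d = m ∸ n
  x = qPow n
  z = qPow d
  u = I n
  v = I m
  w = I d
  t = I (m ℕ.+ n)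
  1≤m+n : 1 ≤ m ℕ.+ n
  1≤m+n = ℕP.≤-trans 1≤n (ℕP.m≤n+m n m)
  qᵐ≈xz : qPow m ≈ x ⊛ z
  qᵐ≈xz = qPow-split n d (ℕP.m+[n∸m]≡n (ℕP.<⇒≤ n<m))
  qᵐ⁺ⁿ≈xxz : qPow (m ℕ.+ n) ≈ x ⊛ x ⊛ z
  qᵐ⁺ⁿ≈xxz = ≈-trans (qPow-split n m (ℕP.+-comm n m))
    (≈-trans (⊛-congˡ x qᵐ≈xz) (≈-sym (⊛-assoc x x z)))
  xzv : (𝟙 ⊕ ⊖ (x ⊛ z)) ⊛ v ≈ 𝟙
  xzv = E-I-at (ℕP.≤-trans 1≤n (ℕP.<⇒≤ n<m)) qᵐ≈xz
  A B C : FPS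
  A = 𝟙 ⊕ ⊖ (x ⊛ z)
  B = 𝟙 ⊕ ⊖ z
  C = 𝟙 ⊕ ⊖ (x ⊛ x ⊛ z)
  Eₘ : E m ≈ A
  Eₘ = ⊕-congˡ 𝟙 (⊖-cong qᵐ≈xz)
  x-xz : x ⊕ ⊖ (x ⊛ z) ≈ x ⊛ B
  x-xz = solve 2 (λ x z → x :- x :* z := x :* (con 1ℤ :- z)) ≈-refl x z
  C-assoc : 𝟙 ⊕ ⊖ (x ⊛ (x ⊛ z)) ≈ C
  C-assoc = ⊕-congˡ 𝟙 (⊖-cong (≈-sym (⊛-assoc x x z)))

-- F n m ⊛ (α n - α m) = α n when m < n.  With y = qᵐ, z = q^{n-m} the claim is
-- -z(1-y)²/((1-z)(1-y²z)) · (yz/(1-yz)² - y/(1-y)²) = yz/(1-yz)².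
F-quotient-below : ∀ n m → 1 ≤ m → m < n → F n m ⊛ (α n ⊕ ⊖ α m) ≈ α n
F-quotient-below n m 1≤m m<n = begin
  F n m ⊛ (α n ⊕ ⊖ α m)
    ≈⟨ ⊛-cong (≡⇒≈ (F-below n m m<n)) (⊕-congʳ (⊖ α m) αₙ≈) ⟩
  ⊖ (z ⊛ A ⊛ A ⊛ w ⊛ t) ⊛ ((y ⊛ z) ⊛ (u ⊛ u) ⊕ ⊖ (y ⊛ (v ⊛ v)))
    ≈⟨ ⊛-congˡ (⊖ (z ⊛ A ⊛ A ⊛ w ⊛ t)) (α-shape-difference (y ⊛ z) y u v yzu (E-I m 1≤m)) ⟩
  ⊖ (z ⊛ A ⊛ A ⊛ w ⊛ t) ⊛ ((y ⊛ z ⊕ ⊖ y) ⊛ (𝟙 ⊕ ⊖ (y ⊛ z ⊛ y)) ⊛ (u ⊛ u) ⊛ (v ⊛ v))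
    ≈⟨ ⊛-congˡ (⊖ (z ⊛ A ⊛ A ⊛ w ⊛ t)) (⊛-congʳ (v ⊛ v) (⊛-congʳ (u ⊛ u) (⊛-cong yz-y C-comm))) ⟩
  ⊖ (z ⊛ A ⊛ A ⊛ w ⊛ t) ⊛ (⊖ (y ⊛ B) ⊛ C ⊛ (u ⊛ u) ⊛ (v ⊛ v))
    ≈⟨ solve 9 (λ y z A B C u v w t →
         :- (z :* A :* A :* w :* t) :* (:- (y :* B) :* C :* (u :* u) :* (v :* v))
         := (y :* z) :* (u :* u) :* ((A :* v) :* (A :* v)) :* (B :* w) :* (C :* t)) ≈-refl y z A B C u v w t ⟩
  (y ⊛ z) ⊛ (u ⊛ u) ⊛ ((A ⊛ v) ⊛ (A ⊛ v)) ⊛ (B ⊛ w) ⊛ (C ⊛ t)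
    ≈⟨ drop-unit-factors ((y ⊛ z) ⊛ (u ⊛ u)) (E-I m 1≤m) (E-I d (ℕP.m<n⇒0<n∸m m<n)) (E-I-at 1≤n+m qⁿ⁺ᵐ≈yyz) ⟩
  (y ⊛ z) ⊛ (u ⊛ u)
    ≈⟨ ≈-sym αₙ≈ ⟩
  α n ∎
  where
  open ≈-Reasoning
  d : ℕ
  y z u v w t : FPS
  d = n ∸ m
  y = qPow m
  z = qPow d
  u = I n
  v = I m
  w = I d
  t = I (n ℕ.+ m)
  A B C : FPS
  A = E m
  B = 𝟙 ⊕ ⊖ z
  C = 𝟙 ⊕ ⊖ (y ⊛ y ⊛ z)
  1≤n+m : 1 ≤ n ℕ.+ m
  1≤n+m = ℕP.≤-trans 1≤m (ℕP.m≤n+m m n)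
  qⁿ≈yz : qPow n ≈ y ⊛ z
  qⁿ≈yz = qPow-split m d (ℕP.m+[n∸m]≡n (ℕP.<⇒≤ m<n))
  qⁿ⁺ᵐ≈yyz : qPow (n ℕ.+ m) ≈ y ⊛ y ⊛ z
  qⁿ⁺ᵐ≈yyz = ≈-trans (qPow-split m n (ℕP.+-comm m n))
    (≈-trans (⊛-congˡ y qⁿ≈yz) (≈-sym (⊛-assoc y y z)))
  αₙ≈ : α n ≈ (y ⊛ z) ⊛ (u ⊛ u)
  αₙ≈ = ⊛-congʳ (u ⊛ u) qⁿ≈yz
  yzu : (𝟙 ⊕ ⊖ (y ⊛ z)) ⊛ u ≈ 𝟙
  yzu = E-I-at (ℕP.≤-trans 1≤m (ℕP.<⇒≤ m<n)) qⁿ≈yz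
  yz-y : y ⊛ z ⊕ ⊖ y ≈ ⊖ (y ⊛ B)
  yz-y = solve 2 (λ y z → y :* z :- y := :- (y :* (con 1ℤ :- z))) ≈-refl y z
  C-comm : 𝟙 ⊕ ⊖ (y ⊛ z ⊛ y) ≈ C
  C-comm = solve 2 (λ y z → con 1ℤ :- y :* z :* y := con 1ℤ :- y :* y :* z) ≈-refl y z

F-quotient : ∀ n m → 1 ≤ n → 1 ≤ m → ¬ n ≡ m → F n m ⊛ (α n ⊕ ⊖ α m) ≈ α n
F-quotient n m 1≤n 1≤m n≢m with ℕP.<-cmp n m
... | tri< n<m _ _ = F-quotient-above n m 1≤n n<m
... | tri≈ _ n≡m _ = ⊥-elim (n≢m n≡m)
... | tri> _ _ m<n = F-quotient-below n m 1≤m m<n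

-- The Lagrange weight of the node n in the index list S,
-- Π_{m ∈ S} F n m = Π_{m ∈ S, m ≠ n} α n / (α n - α m).
weight : List ℕ → ℕ → FPS
weight S n = ΠL (map (F n) S)

-- H i S = Σ_{n ∈ S} weight S n · (α n)^i, the partial-fraction expression which
-- will turn out to be the complete homogeneous symmetric function h i.
H : ℕ → List ℕ → FPS
H i S = ΣL (map (λ n → weight S n ⊛ α n ^ i) S)

h : ℕ → List ℕ → FPS
h zero    S       = 𝟙
h (suc i) []      = 𝟘
h (suc i) (p ∷ S) = α p ⊛ h i (p ∷ S) ⊕ h (suc i) S

h-one : ∀ S → h 1 S ≈ ΣL (map α S)
h-one []      = ≈-refl
h-one (p ∷ S) = ⊕-cong (⊛-identityʳ (α p)) (h-one S)

-- One summand of H (suc i) (p ∷ S), for n ≠ p: since F n p = α n/(α n - α p),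
-- F n p · w · α n · P = α p · (F n p · w · P) + w · α n · P.
split-summand : ∀ f w a b P → f ⊛ (a ⊕ ⊖ b) ≈ a →
  (f ⊛ w) ⊛ (a ⊛ P) ≈ b ⊛ ((f ⊛ w) ⊛ P) ⊕ w ⊛ (a ⊛ P)
split-summand f w a b P quotient = begin
  (f ⊛ w) ⊛ (a ⊛ P)
    ≈⟨ solve 5 (λ f w a b P → (f :* w) :* (a :* P) := b :* ((f :* w) :* P) :+ (f :* (a :- b)) :* (w :* P)) ≈-refl f w a b P ⟩
  b ⊛ ((f ⊛ w) ⊛ P) ⊕ (f ⊛ (a ⊕ ⊖ b)) ⊛ (w ⊛ P)
    ≈⟨ ⊕-congˡ (b ⊛ ((f ⊛ w) ⊛ P)) (⊛-congʳ (w ⊛ P) quotient) ⟩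
  b ⊛ ((f ⊛ w) ⊛ P) ⊕ a ⊛ (w ⊛ P)
    ≈⟨ ⊕-congˡ (b ⊛ ((f ⊛ w) ⊛ P)) (solve 3 (λ a w P → a :* (w :* P) := w :* (a :* P)) ≈-refl a w P) ⟩
  b ⊛ ((f ⊛ w) ⊛ P) ⊕ w ⊛ (a ⊛ P) ∎
  where open ≈-Reasoning

-- Removing a node p from H lowers the degree: the partial-fraction analogue of the
-- recursion of h.
H-peel : ∀ i p S → 1 ≤ p → (∀ {n} → n ∈ S → 1 ≤ n × ¬ n ≡ p) →
  H (suc i) (p ∷ S) ≈ α p ⊛ H i (p ∷ S) ⊕ H (suc i) S
H-peel i p S 1≤p nodes = begin
  wₚ ⊛ (α p ⊛ α p ^ i) ⊕ ΣL (map (λ n → weight (p ∷ S) n ⊛ α n ^ suc i) S)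
    ≈⟨ ⊕-cong (solve 3 (λ w a P → w :* (a :* P) := a :* (w :* P)) ≈-refl wₚ (α p) (α p ^ i))
              (ΣL-cong S (λ {n} n∈S → split-summand (F n p) (weight S n) (α n) (α p) (α n ^ i)
                                        (F-quotient n p (proj₁ (nodes n∈S)) 1≤p (proj₂ (nodes n∈S))))) ⟩
  α p ⊛ Tₚ ⊕ ΣL (map (λ n → α p ⊛ T n ⊕ weight S n ⊛ α n ^ suc i) S)
    ≈⟨ ⊕-congˡ (α p ⊛ Tₚ) (ΣL-⊕ (λ n → α p ⊛ T n) (λ n → weight S n ⊛ α n ^ suc i) S) ⟩
  α p ⊛ Tₚ ⊕ (ΣL (map (λ n → α p ⊛ T n) S) ⊕ H (suc i) S)
    ≈⟨ ⊕-congˡ (α p ⊛ Tₚ) (⊕-congʳ (H (suc i) S) (≈-sym (ΣL-⊛ (α p) T S))) ⟩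
  α p ⊛ Tₚ ⊕ (α p ⊛ ΣL (map T S) ⊕ H (suc i) S)
    ≈⟨ solve 4 (λ a x y z → a :* x :+ (a :* y :+ z) := a :* (x :+ y) :+ z) ≈-refl (α p) Tₚ (ΣL (map T S)) (H (suc i) S) ⟩
  α p ⊛ H i (p ∷ S) ⊕ H (suc i) S ∎
  where
  open ≈-Reasoning
  wₚ : FPS
  wₚ = weight (p ∷ S) p
  T : ℕ → FPS
  T n = weight (p ∷ S) n ⊛ α n ^ i
  Tₚ : FPS
  Tₚ = T p

H-rotate : ∀ i S p → H i (S ++ p ∷ []) ≈ H i (p ∷ S)
H-rotate i S p = ≈-trans
  (ΣL-cong (S ++ p ∷ []) (λ {n} _ → ⊛-congʳ (α n ^ i) (ΠL-rotate (F n) S p)))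
  (ΣL-rotate (λ n → weight (p ∷ S) n ⊛ α n ^ i) S p)

-- αₙ is not a zero divisor: it is qⁿ times the unit 1/(1-qⁿ)².
α-cancel : ∀ n → 1 ≤ n → ∀ f → α n ⊛ f ≈ 𝟘 → f ≈ 𝟘
α-cancel n 1≤n f αf≈0 = qPow-cancel n f (begin
  qPow n ⊛ f
    ≈⟨ ≈-sym (times-1 (qPow n ⊛ f) (square-1 (E-I n 1≤n))) ⟩
  qPow n ⊛ f ⊛ ((E n ⊛ I n) ⊛ (E n ⊛ I n))
    ≈⟨ solve 4 (λ x f e i → x :* f :* ((e :* i) :* (e :* i)) := e :* e :* (x :* (i :* i) :* f)) ≈-refl (qPow n) f (E n) (I n) ⟩
  E n ⊛ E n ⊛ (α n ⊛ f)
    ≈⟨ ⊛-congˡ (E n ⊛ E n) αf≈0 ⟩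
  E n ⊛ E n ⊛ 𝟘
    ≈⟨ zeroʳ (E n ⊛ E n) ⟩
  𝟘 ∎)
  where open ≈-Reasoning

-- Neither is αₙ - αₘ for n ≠ m: multiplying it by F n m gives αₙ.
α-difference-cancel : ∀ n m → 1 ≤ n → 1 ≤ m → ¬ n ≡ m → ∀ f → (α n ⊕ ⊖ α m) ⊛ f ≈ 𝟘 → f ≈ 𝟘
α-difference-cancel n m 1≤n 1≤m n≢m f Df≈0 = α-cancel n 1≤n f (begin
  α n ⊛ f                       ≈⟨ ⊛-congʳ f (≈-sym (F-quotient n m 1≤n 1≤m n≢m)) ⟩
  F n m ⊛ (α n ⊕ ⊖ α m) ⊛ f     ≈⟨ ⊛-assoc (F n m) (α n ⊕ ⊖ α m) f ⟩
  F n m ⊛ ((α n ⊕ ⊖ α m) ⊛ f)   ≈⟨ ⊛-congˡ (F n m) Df≈0 ⟩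
  F n m ⊛ 𝟘                     ≈⟨ zeroʳ (F n m) ⟩
  𝟘 ∎)
  where open ≈-Reasoning

nodes-after : ∀ lo L → 1 ≤ lo → ∀ {n} → n ∈ interval (suc lo) L → 1 ≤ n × ¬ n ≡ lo
nodes-after lo L 1≤lo n∈ with ∈-interval (suc lo) L n∈
... | lo<n , _ = ℕP.≤-trans 1≤lo (ℕP.<⇒≤ lo<n) , ℕP.>⇒≢ lo<n

nodes-before : ∀ lo L → 1 ≤ lo → ∀ {n} → n ∈ interval lo L → 1 ≤ n × ¬ n ≡ lo ℕ.+ L
nodes-before lo L 1≤lo n∈ with ∈-interval lo L n∈
... | lo≤n , n<hi = ℕP.≤-trans 1≤lo lo≤n , ℕP.<⇒≢ n<hi

mutual
  -- On a nonempty interval of positive indices, H 0 = 1.  For an interval with two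
  -- ends lo < hi, removing either end (H-peel) expresses H 1 in terms of H 0 and
  -- of shorter intervals; comparing gives (α lo - α hi)(H 0 - 1) = 0.
  H-zero : ∀ L lo → 1 ≤ lo → H 0 (interval lo (suc L)) ≈ 𝟙
  H-zero zero    lo 1≤lo = mk≈ λ N → trans (ℤP.+-identityʳ _)
    (at (≈-trans (⊛-identityʳ (F lo lo ⊛ 𝟙)) (≈-trans (⊛-identityʳ (F lo lo)) (≡⇒≈ (F-diag lo)))) N)
  H-zero (suc L) lo 1≤lo = difference-zero⇒≈
    (α-difference-cancel lo hi 1≤lo 1≤hi (ℕP.<⇒≢ lo<hi) (H₀ ⊕ ⊖ 𝟙) (begin
      (α lo ⊕ ⊖ α hi) ⊛ (H₀ ⊕ ⊖ 𝟙)
        ≈⟨ solve 5 (λ a b H X Y → (a :- b) :* (H :- con 1ℤ)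
                     := (a :* H :+ X :- (b :* H :+ Y)) :- (a :+ X :- (Y :+ b))) ≈-refl (α lo) (α hi) H₀ X Y ⟩
      (α lo ⊛ H₀ ⊕ X ⊕ ⊖ (α hi ⊛ H₀ ⊕ Y)) ⊕ ⊖ (α lo ⊕ X ⊕ ⊖ (Y ⊕ α hi))
        ≈⟨ ⊕-cong (≈⇒difference-zero (≈-trans (≈-sym from-low) from-high))
                  (⊖-cong (≈⇒difference-zero sum-of-α)) ⟩
      𝟘 ⊕ ⊖ 𝟘
        ≈⟨ mk≈ (λ _ → refl) ⟩
      𝟘 ∎))
    where
    open ≈-Reasoning
    hi : ℕ
    hi = lo ℕ.+ suc L
    S : List ℕ
    S  = interval lo (suc L)
    H₀ X Y : FPS
    H₀ = H 0 (interval lo (suc (suc L)))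
    X  = h 1 (interval (suc lo) (suc L))
    Y  = h 1 S
    lo<hi : lo < hi
    lo<hi = ℕP.m<m+n lo (s≤s z≤n)
    1≤hi : 1 ≤ hi
    1≤hi = ℕP.≤-trans 1≤lo (ℕP.<⇒≤ lo<hi)
    full≡ : interval lo (suc (suc L)) ≡ S ++ hi ∷ []
    full≡ = interval-snoc lo (suc L)
    sum-of-α : α lo ⊕ X ≈ Y ⊕ α hi
    sum-of-α = ≈-trans (⊕-congˡ (α lo) (h-one (interval (suc lo) (suc L))))
                       (≈-trans (ΣL-snoc α lo (suc L)) (⊕-congʳ (α hi) (≈-sym (h-one S))))
    from-low : H 1 (interval lo (suc (suc L))) ≈ α lo ⊛ H₀ ⊕ X
    from-low = ≈-trans (H-peel 0 lo (interval (suc lo) (suc L)) 1≤lo (nodes-after lo (suc L) 1≤lo))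
                       (⊕-congˡ (α lo ⊛ H₀) (H≈h L (suc lo) (ℕP.≤-trans 1≤lo (ℕP.n≤1+n lo)) 1))
    from-high : H 1 (interval lo (suc (suc L))) ≈ α hi ⊛ H₀ ⊕ Y
    from-high = begin
      H 1 (interval lo (suc (suc L)))  ≡⟨ cong (H 1) full≡ ⟩
      H 1 (S ++ hi ∷ [])               ≈⟨ H-rotate 1 S hi ⟩
      H 1 (hi ∷ S)                     ≈⟨ H-peel 0 hi S 1≤hi (nodes-before lo (suc L) 1≤lo) ⟩
      α hi ⊛ H 0 (hi ∷ S) ⊕ H 1 S      ≈⟨ ⊕-cong (⊛-congˡ (α hi) (≈-sym (≈-trans (≡⇒≈ (cong (H 0) full≡)) (H-rotate 0 S hi))))
                                                 (H≈h L lo 1≤lo 1) ⟩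
      α hi ⊛ H₀ ⊕ Y                    ∎

  H≈h : ∀ L lo → 1 ≤ lo → ∀ i → H i (interval lo (suc L)) ≈ h i (interval lo (suc L))
  H≈h L lo 1≤lo zero    = H-zero L lo 1≤lo
  H≈h L lo 1≤lo (suc i) = ≈-trans (H-peel i lo (interval (suc lo) L) 1≤lo (nodes-after lo L 1≤lo))
    (⊕-cong (⊛-congˡ (α lo) (H≈h L lo 1≤lo i)) (H≈h-positive L (suc lo) (ℕP.≤-trans 1≤lo (ℕP.n≤1+n lo)) i))

  H≈h-positive : ∀ L lo → 1 ≤ lo → ∀ i → H (suc i) (interval lo L) ≈ h (suc i) (interval lo L)
  H≈h-positive zero    lo _    i = ≈-refl
  H≈h-positive (suc L) lo 1≤lo i = H≈h L lo 1≤lo (suc i)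

lhsTerm≈ : ∀ ns → lhsTerm ns ≈ ΠL (map α ns)
lhsTerm≈ []       = ⊛-identityˡ 𝟙
lhsTerm≈ (n ∷ ns) = begin
  qPow (n ℕ.+ sum ns) ⊛ ((I n ⊛ (I n ⊛ 𝟙)) ⊛ rest)
    ≈⟨ ⊛-cong (qPow-split n (sum ns) refl) (⊛-congʳ rest (⊛-congˡ (I n) (⊛-identityʳ (I n)))) ⟩
  (qPow n ⊛ qPow (sum ns)) ⊛ ((I n ⊛ I n) ⊛ rest)
    ≈⟨ solve 4 (λ x s i r → (x :* s) :* ((i :* i) :* r) := (x :* (i :* i)) :* (s :* r)) ≈-refl (qPow n) (qPow (sum ns)) (I n) rest ⟩
  α n ⊛ lhsTerm ns
    ≈⟨ ⊛-congˡ (α n) (lhsTerm≈ ns) ⟩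
  α n ⊛ ΠL (map α ns) ∎
  where
  open ≈-Reasoning
  rest : FPS
  rest = foldr (λ m acc → (I m ^ 2) ⊛ acc) 𝟙 ns

ΣL-concatMap : ∀ {A B : Set} (g : B → FPS) (f : A → List B) xs →
  ΣL (map g (concatMap f xs)) ≈ ΣL (map (λ x → ΣL (map g (f x))) xs)
ΣL-concatMap g f []       = ≈-refl
ΣL-concatMap g f (x ∷ xs) = ≈-trans (ΣL-++ g (f x) (concatMap f xs)) (⊕-congˡ (ΣL (map g (f x))) (ΣL-concatMap g f xs))

chainSum : ℕ → ℕ → ℕ → FPS
chainSum k lo M = ΣL (map (ΠL ∘ map α) (chainsFrom lo k M))

chainSum-suc : ∀ k lo M → chainSum (suc k) lo M ≈ ΣL (map (λ n → α n ⊛ chainSum k n M) (range lo M))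
chainSum-suc k lo M = ≈-trans (ΣL-concatMap (ΠL ∘ map α) (λ n → map (n ∷_) (chainsFrom n k M)) (range lo M))
  (ΣL-cong (range lo M) (λ {n} _ → ≈-trans (≡⇒≈ (cong ΣL (sym (map-∘ (chainsFrom n k M)))))
                                          (≈-sym (ΣL-⊛ (α n) (ΠL ∘ map α) (chainsFrom n k M)))))

h-suc-interval : ∀ k top lo L → lo ℕ.+ L ≡ top →
  ΣL (map (λ n → α n ⊛ h k (interval n (top ∸ n))) (interval lo L)) ≈ h (suc k) (interval lo L)
h-suc-interval k top lo zero    _     = ≈-refl
h-suc-interval k top lo (suc L) refl = ⊕-cong
  (⊛-congˡ (α lo) (≡⇒≈ (cong (h k ∘ interval lo) (ℕP.m+n∸m≡n lo (suc L)))))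
  (h-suc-interval k (lo ℕ.+ suc L) (suc lo) L (sym (ℕP.+-suc lo L)))

chainSum≈h : ∀ k lo M → lo ≤ suc M → chainSum k lo M ≈ h k (interval lo (suc M ∸ lo))
chainSum≈h zero    lo M _       = mk≈ λ N → ℤP.+-identityʳ (𝟙 N)
chainSum≈h (suc k) lo M lo≤M+1 = begin
  chainSum (suc k) lo M
    ≈⟨ chainSum-suc k lo M ⟩
  ΣL (map (λ n → α n ⊛ chainSum k n M) (range lo M))
    ≡⟨ cong (ΣL ∘ map (λ n → α n ⊛ chainSum k n M)) (range-interval lo M) ⟩
  ΣL (map (λ n → α n ⊛ chainSum k n M) (interval lo (suc M ∸ lo)))
    ≈⟨ ΣL-cong (interval lo (suc M ∸ lo)) (λ {n} n∈ → ⊛-congˡ (α n) (chainSum≈h k n M (n≤M+1 n∈))) ⟩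
  ΣL (map (λ n → α n ⊛ h k (interval n (suc M ∸ n))) (interval lo (suc M ∸ lo)))
    ≈⟨ h-suc-interval k (suc M) lo (suc M ∸ lo) (ℕP.m+[n∸m]≡n lo≤M+1) ⟩
  h (suc k) (interval lo (suc M ∸ lo)) ∎
  where
  open ≈-Reasoning
  n≤M+1 : ∀ {n} → n ∈ interval lo (suc M ∸ lo) → n ≤ suc M
  n≤M+1 {n} n∈ = ℕP.<⇒≤ (subst (n <_) (ℕP.m+[n∸m]≡n lo≤M+1) (proj₂ (∈-interval lo (suc M ∸ lo) n∈)))

lhsPartial≈H : ∀ j M → lhsPartial (suc j) M ≈ H (suc j) (interval 1 M)
lhsPartial≈H j M = begin
  lhsPartial (suc j) M          ≈⟨ ΣL-cong (chains (suc j) M) (λ {ns} _ → lhsTerm≈ ns) ⟩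
  chainSum (suc j) 1 M          ≈⟨ chainSum≈h (suc j) 1 M (s≤s z≤n) ⟩
  h (suc j) (interval 1 M)      ≈⟨ ≈-sym (H≈h-positive M 1 ℕP.≤-refl j) ⟩
  H (suc j) (interval 1 M)      ∎
  where open ≈-Reasoning

E-product : ℕ → ℕ → FPS
E-product s L = ΠL (map E (interval s L))

E-product-inverse : ∀ xs → (∀ {m} → m ∈ xs → 1 ≤ m) → ΠL (map E xs) ⊛ ΠL (map I xs) ≈ 𝟙
E-product-inverse []       _        = ⊛-identityˡ 𝟙
E-product-inverse (m ∷ xs) positive = begin
  (E m ⊛ ΠL (map E xs)) ⊛ (I m ⊛ ΠL (map I xs))
    ≈⟨ solve 4 (λ e P i Q → (e :* P) :* (i :* Q) := (e :* i) :* (P :* Q)) ≈-refl (E m) (ΠL (map E xs)) (I m) (ΠL (map I xs)) ⟩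
  (E m ⊛ I m) ⊛ (ΠL (map E xs) ⊛ ΠL (map I xs))
    ≈⟨ ⊛-cong (E-I m (positive (here refl))) (E-product-inverse xs (positive ∘ there)) ⟩
  𝟙 ⊛ 𝟙
    ≈⟨ ⊛-identityˡ 𝟙 ⟩
  𝟙 ∎
  where open ≈-Reasoning

ΠL-reverse : ∀ (g : ℕ → FPS) p → ΠL (map (λ m → g (suc p ∸ m)) (interval 1 p)) ≈ ΠL (map g (interval 1 p))
ΠL-reverse g zero    = ≈-refl
ΠL-reverse g (suc p) = begin
  g (suc p) ⊛ ΠL (map (λ m → g (2 ℕ.+ p ∸ m)) (interval 2 p))
    ≡⟨ cong (λ xs → g (suc p) ⊛ ΠL xs) (trans (cong (map (λ m → g (2 ℕ.+ p ∸ m))) (sym (interval-shift 1 1 p)))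
                                               (sym (map-∘ (interval 1 p)))) ⟩
  g (suc p) ⊛ ΠL (map (λ m → g (suc p ∸ m)) (interval 1 p))
    ≈⟨ ⊛-congˡ (g (suc p)) (ΠL-reverse g p) ⟩
  g (suc p) ⊛ ΠL (map g (interval 1 p))
    ≈⟨ ≈-sym (≈-trans (ΠL-snoc g 1 p) (⊛-comm (ΠL (map g (interval 1 p))) (g (suc p)))) ⟩
  ΠL (map g (interval 1 (suc p))) ∎
  where open ≈-Reasoning

ΠL-negate : ∀ (g : ℕ → FPS) lo L → ΠL (map (λ m → ⊖ g m) (interval lo L)) ≈ constant ((- 1ℤ) ℤ.^ L) ⊛ ΠL (map g (interval lo L))
ΠL-negate g lo zero    = ≈-sym (⊛-identityˡ 𝟙)
ΠL-negate g lo (suc L) = begin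
  ⊖ g lo ⊛ ΠL (map (λ m → ⊖ g m) (interval (suc lo) L))
    ≈⟨ ⊛-congˡ (⊖ g lo) (ΠL-negate g (suc lo) L) ⟩
  ⊖ g lo ⊛ (constant s ⊛ P)
    ≈⟨ solve 3 (λ x c P → :- x :* (c :* P) := con (- 1ℤ) :* c :* (x :* P)) ≈-refl (g lo) (constant s) P ⟩
  constant (- 1ℤ) ⊛ constant s ⊛ (g lo ⊛ P)
    ≈⟨ ⊛-congʳ (g lo ⊛ P) (≈-sym (constant-* (- 1ℤ) s)) ⟩
  constant ((- 1ℤ) ℤ.^ suc L) ⊛ (g lo ⊛ P) ∎
  where
  open ≈-Reasoning
  s : ℤ
  P : FPS
  s = (- 1ℤ) ℤ.^ L
  P = ΠL (map g (interval (suc lo) L))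

ΠL-qPow : ∀ xs → ΠL (map qPow xs) ≈ qPow (sum xs)
ΠL-qPow []       = ≈-refl
ΠL-qPow (x ∷ xs) = ≈-trans (⊛-congˡ (qPow x) (ΠL-qPow xs)) (qPow-+ x (sum xs))

triangular : ℕ → ℕ
triangular n = (n ℕ.* (n ∸ 1)) / 2

triangular-sum : ∀ p → triangular (suc p) ≡ sum (interval 1 p)
triangular-sum p = trans (cong (_/ 2) (sym (twice-sum p))) (m*n/n≡m (sum (interval 1 p)) 2)
  where
  twice-sum : ∀ p → sum (interval 1 p) ℕ.* 2 ≡ suc p ℕ.* p
  twice-sum zero    = refl
  twice-sum (suc p) = begin
    sum (interval 1 (suc p)) ℕ.* 2
      ≡⟨ cong (λ xs → sum xs ℕ.* 2) (interval-snoc 1 p) ⟩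
    sum (interval 1 p ++ suc p ∷ []) ℕ.* 2
      ≡⟨ cong (ℕ._* 2) (sum-++ (interval 1 p) (suc p ∷ [])) ⟩
    (sum (interval 1 p) ℕ.+ (suc p ℕ.+ 0)) ℕ.* 2
      ≡⟨ expand (sum (interval 1 p)) p ⟩
    sum (interval 1 p) ℕ.* 2 ℕ.+ 2 ℕ.* suc p
      ≡⟨ cong (ℕ._+ 2 ℕ.* suc p) (twice-sum p) ⟩
    suc p ℕ.* p ℕ.+ 2 ℕ.* suc p
      ≡⟨ collect p ⟩
    suc (suc p) ℕ.* suc p ∎
    where
    open ≡-Reasoning
    expand : ∀ S p → (S ℕ.+ (suc p ℕ.+ 0)) ℕ.* 2 ≡ S ℕ.* 2 ℕ.+ 2 ℕ.* suc p
    expand = ℕ-solve-∀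
    collect : ∀ p → suc p ℕ.* p ℕ.+ 2 ℕ.* suc p ≡ suc (suc p) ℕ.* suc p
    collect = ℕ-solve-∀

-- The coefficient series of α nᵏ on the right-hand side:
-- (-1)^{n-1} q^{n(n-1)/2} (1 + qⁿ).  It is the q-adic limit of weight [1, M] n.
limit-weight : ℕ → FPS
limit-weight n = constant ((- 1ℤ) ℤ.^ (n ∸ 1)) ⊛ (qPow (triangular n) ⊛ (𝟙 ⊕ qPow n))

F-below-normalised : ∀ n m → m < n → F n m ⊛ E (n ∸ m) ⊛ E (n ℕ.+ m) ≈ ⊖ (qPow (n ∸ m) ⊛ (E m ⊛ E m))
F-below-normalised n m m<n = begin
  F n m ⊛ E (n ∸ m) ⊛ E (n ℕ.+ m)
    ≈⟨ ⊛-congʳ (E (n ℕ.+ m)) (⊛-congʳ (E (n ∸ m)) (≡⇒≈ (F-below n m m<n))) ⟩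
  ⊖ (qPow (n ∸ m) ⊛ E m ⊛ E m ⊛ I (n ∸ m) ⊛ I (n ℕ.+ m)) ⊛ E (n ∸ m) ⊛ E (n ℕ.+ m)
    ≈⟨ solve 6 (λ x e i j e' e'' → :- (x :* e :* e :* i :* j) :* e' :* e'' := :- (x :* (e :* e)) :* (e' :* i) :* (e'' :* j))
         ≈-refl (qPow (n ∸ m)) (E m) (I (n ∸ m)) (I (n ℕ.+ m)) (E (n ∸ m)) (E (n ℕ.+ m)) ⟩
  ⊖ (qPow (n ∸ m) ⊛ (E m ⊛ E m)) ⊛ (E (n ∸ m) ⊛ I (n ∸ m)) ⊛ (E (n ℕ.+ m) ⊛ I (n ℕ.+ m))
    ≈⟨ ⊛-cong (times-1 (⊖ (qPow (n ∸ m) ⊛ (E m ⊛ E m))) (E-I (n ∸ m) (ℕP.m<n⇒0<n∸m m<n))) (E-I (n ℕ.+ m) (ℕP.≤-trans (ℕP.≤-trans (s≤s z≤n) m<n) (ℕP.m≤m+n n m))) ⟩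
  ⊖ (qPow (n ∸ m) ⊛ (E m ⊛ E m)) ⊛ 𝟙
    ≈⟨ ⊛-identityʳ _ ⟩
  ⊖ (qPow (n ∸ m) ⊛ (E m ⊛ E m)) ∎
  where open ≈-Reasoning

-- The weights of the nodes m < n in weight [1, n] n, normalised by the factors
-- 1 - qᵐ and 1 - q^{n+m}: the signs give (-1)^{n-1} and the powers of q give
-- q^{(n-1) + ⋯ + 1}.
below-product : ∀ p →
  ΠL (map (F (suc p)) (interval 1 p)) ⊛ E-product 1 p ⊛ ΠL (map (λ m → E (suc p ℕ.+ m)) (interval 1 p))
  ≈ constant ((- 1ℤ) ℤ.^ p) ⊛ (qPow (triangular (suc p)) ⊛ (E-product 1 p ⊛ E-product 1 p))
below-product p = begin
  ΠL (map (F n) xs) ⊛ E-product 1 p ⊛ ΠL (map (λ m → E (n ℕ.+ m)) xs)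
    ≈⟨ ⊛-congʳ (ΠL (map (λ m → E (n ℕ.+ m)) xs)) (⊛-congˡ (ΠL (map (F n) xs)) (≈-sym (ΠL-reverse E p))) ⟩
  ΠL (map (F n) xs) ⊛ ΠL (map (λ m → E (n ∸ m)) xs) ⊛ ΠL (map (λ m → E (n ℕ.+ m)) xs)
    ≈⟨ ≈-sym (≈-trans (ΠL-⊛ (λ m → F n m ⊛ E (n ∸ m)) (λ m → E (n ℕ.+ m)) xs)
                      (⊛-congʳ (ΠL (map (λ m → E (n ℕ.+ m)) xs)) (ΠL-⊛ (F n) (λ m → E (n ∸ m)) xs))) ⟩
  ΠL (map (λ m → F n m ⊛ E (n ∸ m) ⊛ E (n ℕ.+ m)) xs)
    ≈⟨ ΠL-cong xs (λ {m} m∈ → F-below-normalised n m (proj₂ (∈-interval 1 p m∈))) ⟩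
  ΠL (map (λ m → ⊖ (qPow (n ∸ m) ⊛ (E m ⊛ E m))) xs)
    ≈⟨ ΠL-negate (λ m → qPow (n ∸ m) ⊛ (E m ⊛ E m)) 1 p ⟩
  constant ((- 1ℤ) ℤ.^ p) ⊛ ΠL (map (λ m → qPow (n ∸ m) ⊛ (E m ⊛ E m)) xs)
    ≈⟨ ⊛-congˡ (constant ((- 1ℤ) ℤ.^ p))
         (≈-trans (ΠL-⊛ (λ m → qPow (n ∸ m)) (λ m → E m ⊛ E m) xs)
                  (⊛-congˡ (ΠL (map (λ m → qPow (n ∸ m)) xs)) (ΠL-⊛ E E xs))) ⟩
  constant ((- 1ℤ) ℤ.^ p) ⊛ (ΠL (map (λ m → qPow (n ∸ m)) xs) ⊛ (E-product 1 p ⊛ E-product 1 p))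
    ≈⟨ ⊛-congˡ (constant ((- 1ℤ) ℤ.^ p)) (⊛-congʳ (E-product 1 p ⊛ E-product 1 p)
         (≈-trans (ΠL-reverse qPow p) (≈-trans (ΠL-qPow xs) (qPow-cong (sym (triangular-sum p)))))) ⟩
  constant ((- 1ℤ) ℤ.^ p) ⊛ (qPow (triangular n) ⊛ (E-product 1 p ⊛ E-product 1 p)) ∎
  where
  open ≈-Reasoning
  n : ℕ
  xs : List ℕ
  n = suc p
  xs = interval 1 p

weight-closed-form-start : ∀ p →
  weight (interval 1 (suc p)) (suc p) ⊛ E-product (suc (suc p)) (suc p) ≈ limit-weight (suc p) ⊛ E-product 1 (suc p)
weight-closed-form-start p = begin
  weight (interval 1 n) n ⊛ E-product (suc n) n
    ≈⟨ ⊛-cong weight≈ E-product≈ ⟩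
  Fs ⊛ (B ⊛ E (suc n ℕ.+ p))
    ≈⟨ ≈-sym (times-1 (Fs ⊛ (B ⊛ E (suc n ℕ.+ p))) (E-product-inverse xs (λ m∈ → proj₁ (∈-interval 1 p m∈)))) ⟩
  Fs ⊛ (B ⊛ E (suc n ℕ.+ p)) ⊛ (D ⊛ D⁻¹)
    ≈⟨ solve 5 (λ f b e d d' → f :* (b :* e) :* (d :* d') := f :* d :* b :* e :* d') ≈-refl Fs B (E (suc n ℕ.+ p)) D D⁻¹ ⟩
  Fs ⊛ D ⊛ B ⊛ E (suc n ℕ.+ p) ⊛ D⁻¹
    ≈⟨ ⊛-congʳ D⁻¹ (⊛-cong (below-product p) (⊕-congˡ 𝟙 (⊖-cong (qPow-split n n (ℕP.+-suc n p))))) ⟩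
  constant s ⊛ (qPow (triangular n) ⊛ (D ⊛ D)) ⊛ (𝟙 ⊕ ⊖ (x ⊛ x)) ⊛ D⁻¹
    ≈⟨ solve 5 (λ c t d x d' → c :* (t :* (d :* d)) :* (con 1ℤ :- x :* x) :* d'
                               := c :* (t :* (con 1ℤ :+ x)) :* (d :* (con 1ℤ :- x)) :* (d :* d'))
         ≈-refl (constant s) (qPow (triangular n)) D x D⁻¹ ⟩
  limit-weight n ⊛ (D ⊛ E n) ⊛ (D ⊛ D⁻¹)
    ≈⟨ times-1 (limit-weight n ⊛ (D ⊛ E n)) (E-product-inverse xs (λ m∈ → proj₁ (∈-interval 1 p m∈))) ⟩
  limit-weight n ⊛ (D ⊛ E n)
    ≈⟨ ⊛-congˡ (limit-weight n) (≈-sym (ΠL-snoc E 1 p)) ⟩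
  limit-weight n ⊛ E-product 1 n ∎
  where
  open ≈-Reasoning
  n : ℕ
  xs : List ℕ
  s : ℤ
  x Fs D D⁻¹ B : FPS
  n = suc p
  xs = interval 1 p
  s = (- 1ℤ) ℤ.^ p
  x = qPow n
  Fs = ΠL (map (F n) xs)
  D = E-product 1 p
  D⁻¹ = ΠL (map I xs)
  B = ΠL (map (λ m → E (n ℕ.+ m)) xs)
  weight≈ : weight (interval 1 n) n ≈ Fs
  weight≈ = ≈-trans (ΠL-snoc (F n) 1 p) (times-1 Fs (≡⇒≈ (F-diag n)))
  E-product≈ : E-product (suc n) n ≈ B ⊛ E (suc n ℕ.+ p)
  E-product≈ = ≈-trans (ΠL-snoc E (suc n) p) (⊛-congʳ (E (suc n ℕ.+ p)) (≡⇒≈ (cong ΠL (sym shifted))))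
    where
    shifted : map (λ m → E (n ℕ.+ m)) xs ≡ map E (interval (suc n) p)
    shifted = trans (map-∘ xs) (cong (map E) (trans (interval-shift n 1 p) (cong (λ b → interval b p) (ℕP.+-comm n 1))))

-- Enlarging [1, M] by the node m = M + 1 > n multiplies the weight of n by
-- F n m = (1 - qᵐ)²/((1 - q^{m-n})(1 - q^{m+n})); both sides of the closed form
-- change by the factor (1 - qᵐ)/(1 - q^{m-n}).
weight-closed-form-step : ∀ n t → 1 ≤ n →
  weight (interval 1 (n ℕ.+ t)) n ⊛ E-product (suc (n ℕ.+ t)) n ≈ limit-weight n ⊛ E-product (suc t) n →
  weight (interval 1 (suc (n ℕ.+ t))) n ⊛ E-product (suc (suc (n ℕ.+ t))) n ≈ limit-weight n ⊛ E-product (suc (suc t)) n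
weight-closed-form-step n t 1≤n closed-form = begin
  weight (interval 1 m) n ⊛ P'
    ≈⟨ ⊛-congʳ P' (≈-trans (ΠL-snoc (F n) 1 M) (⊛-congˡ W (≡⇒≈ F≡))) ⟩
  W ⊛ (E m ⊛ E m ⊛ I d ⊛ I (m ℕ.+ n)) ⊛ P'
    ≈⟨ solve 5 (λ w e i j P' → w :* (e :* e :* i :* j) :* P' := w :* e :* i :* j :* (e :* P')) ≈-refl W (E m) (I d) (I (m ℕ.+ n)) P' ⟩
  W ⊛ E m ⊛ I d ⊛ I (m ℕ.+ n) ⊛ (E m ⊛ P')
    ≈⟨ ⊛-congˡ (W ⊛ E m ⊛ I d ⊛ I (m ℕ.+ n)) (ΠL-snoc E m n) ⟩
  W ⊛ E m ⊛ I d ⊛ I (m ℕ.+ n) ⊛ (P ⊛ E (m ℕ.+ n))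
    ≈⟨ solve 6 (λ w e i j P e' → w :* e :* i :* j :* (P :* e') := w :* P :* e :* i :* (e' :* j)) ≈-refl W (E m) (I d) (I (m ℕ.+ n)) P (E (m ℕ.+ n)) ⟩
  W ⊛ P ⊛ E m ⊛ I d ⊛ (E (m ℕ.+ n) ⊛ I (m ℕ.+ n))
    ≈⟨ ⊛-cong (⊛-congʳ (I d) (⊛-congʳ (E m) closed-form)) (E-I (m ℕ.+ n) (ℕP.≤-trans 1≤n (ℕP.m≤n+m n m))) ⟩
  limit-weight n ⊛ Q ⊛ E m ⊛ I d ⊛ 𝟙
    ≈⟨ ⊛-identityʳ (limit-weight n ⊛ Q ⊛ E m ⊛ I d) ⟩
  limit-weight n ⊛ Q ⊛ E m ⊛ I d
    ≈⟨ ⊛-congʳ (I d) (≈-trans (⊛-assoc (limit-weight n) Q (E m))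
         (⊛-congˡ (limit-weight n) (≈-trans (⊛-congˡ Q (≡⇒≈ (cong E m≡d+n))) (≈-sym (ΠL-snoc E d n))))) ⟩
  limit-weight n ⊛ (E d ⊛ Q') ⊛ I d
    ≈⟨ solve 4 (λ c e Q' i → c :* (e :* Q') :* i := c :* Q' :* (e :* i)) ≈-refl (limit-weight n) (E d) Q' (I d) ⟩
  limit-weight n ⊛ Q' ⊛ (E d ⊛ I d)
    ≈⟨ times-1 (limit-weight n ⊛ Q') (E-I d (s≤s z≤n)) ⟩
  limit-weight n ⊛ Q' ∎
  where
  open ≈-Reasoning
  M m d : ℕ
  W P P' Q Q' : FPS
  M = n ℕ.+ t
  m = suc M
  d = suc t
  W = weight (interval 1 M) n
  P = E-product m n
  P' = E-product (suc m) n
  Q = E-product d n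
  Q' = E-product (suc d) n
  m≡d+n : m ≡ d ℕ.+ n
  m≡d+n = cong suc (ℕP.+-comm n t)
  F≡ : F n m ≡ E m ⊛ E m ⊛ I d ⊛ I (m ℕ.+ n)
  F≡ = trans (F-above n m (s≤s (ℕP.m≤m+n n t)))
             (cong (λ k → E m ⊛ E m ⊛ I k ⊛ I (m ℕ.+ n)) (trans (cong (_∸ n) (sym (ℕP.+-suc n t))) (ℕP.m+n∸m≡n n d)))

weight-closed-form : ∀ n t → 1 ≤ n →
  weight (interval 1 (n ℕ.+ t)) n ⊛ E-product (suc (n ℕ.+ t)) n ≈ limit-weight n ⊛ E-product (suc t) n
weight-closed-form (suc p) zero    _   rewrite ℕP.+-identityʳ p = weight-closed-form-start p
weight-closed-form n       (suc t) 1≤n rewrite ℕP.+-suc n t =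
  weight-closed-form-step n t 1≤n (weight-closed-form n t 1≤n)

E-product-≈[] : ∀ s L → E-product s L ≈[ s ] 𝟙
E-product-≈[] s zero    = ≈⇒≈[] s ≈-refl
E-product-≈[] s (suc L) = ≈[]-trans s
  (≈[]-unit s (E s) (E-product (suc s) L) (≈[]-mono (ℕP.n≤1+n s) (E-product-≈[] (suc s) L)))
  (E-≈[] s)

weight-≈[]-limit : ∀ n t → 1 ≤ n → weight (interval 1 (n ℕ.+ t)) n ≈[ suc t ] limit-weight n
weight-≈[]-limit n t 1≤n = ≈[]-trans (suc t)
  (≈[]-sym (suc t) (≈[]-unit (suc t) W (E-product (suc (n ℕ.+ t)) n)
    (≈[]-mono (s≤s (ℕP.m≤n+m t n)) (E-product-≈[] (suc (n ℕ.+ t)) n))))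
  (≈[]-trans (suc t) (≈⇒≈[] (suc t) (weight-closed-form n t 1≤n))
    (≈[]-unit (suc t) (limit-weight n) (E-product (suc t) n) (E-product-≈[] (suc t) n)))
  where W = weight (interval 1 (n ℕ.+ t)) n

^-distrib-⊛ : ∀ f g k → (f ⊛ g) ^ k ≈ f ^ k ⊛ g ^ k
^-distrib-⊛ f g zero    = ≈-sym (⊛-identityˡ 𝟙)
^-distrib-⊛ f g (suc k) = ≈-trans (⊛-congˡ (f ⊛ g) (^-distrib-⊛ f g k))
  (solve 4 (λ f g a b → (f :* g) :* (a :* b) := (f :* a) :* (g :* b)) ≈-refl f g (f ^ k) (g ^ k))

^-+ : ∀ f a b → f ^ (a ℕ.+ b) ≈ f ^ a ⊛ f ^ b
^-+ f zero    b = ≈-sym (⊛-identityˡ (f ^ b))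
^-+ f (suc a) b = ≈-trans (⊛-congˡ f (^-+ f a b)) (≈-sym (⊛-assoc f (f ^ a) (f ^ b)))

^-double : ∀ f k → f ^ (2 ℕ.* k) ≈ (f ⊛ f) ^ k
^-double f k = ≈-trans (^-+ f k (k ℕ.+ 0))
  (≈-trans (⊛-congˡ (f ^ k) (≡⇒≈ (cong (f ^_) (ℕP.+-identityʳ k)))) (≈-sym (^-distrib-⊛ f f k)))

qPow-* : ∀ k n → qPow (k ℕ.* n) ≈ qPow n ^ k
qPow-* zero    n = ≈-refl
qPow-* (suc k) n = ≈-trans (qPow-split n (k ℕ.* n) refl) (⊛-congˡ (qPow n) (qPow-* k n))

rhsTerm≈ : ∀ k n → rhsTerm k n ≈ limit-weight n ⊛ α n ^ k
rhsTerm≈ k n = begin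
  s · (qPow (triangular n ℕ.+ k ℕ.* n) ⊛ (𝟙 ⊕ qPow n) ⊛ I n ^ (2 ℕ.* k))
    ≈⟨ ≈-sym (constant-⊛ s _) ⟩
  constant s ⊛ (qPow (triangular n ℕ.+ k ℕ.* n) ⊛ (𝟙 ⊕ qPow n) ⊛ I n ^ (2 ℕ.* k))
    ≈⟨ ⊛-congˡ (constant s) (⊛-cong (⊛-congʳ (𝟙 ⊕ qPow n) (≈-trans (qPow-split (triangular n) (k ℕ.* n) refl)
                                                                (⊛-congˡ (qPow (triangular n)) (qPow-* k n))))
                                    (^-double (I n) k)) ⟩
  constant s ⊛ ((qPow (triangular n) ⊛ qPow n ^ k) ⊛ (𝟙 ⊕ qPow n) ⊛ (I n ⊛ I n) ^ k)
    ≈⟨ solve 5 (λ c t x o i → c :* ((t :* x) :* o :* i) := (c :* (t :* o)) :* (x :* i))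
         ≈-refl (constant s) (qPow (triangular n)) (qPow n ^ k) (𝟙 ⊕ qPow n) ((I n ⊛ I n) ^ k) ⟩
  limit-weight n ⊛ (qPow n ^ k ⊛ (I n ⊛ I n) ^ k)
    ≈⟨ ⊛-congˡ (limit-weight n) (≈-sym (^-distrib-⊛ (qPow n) (I n ⊛ I n) k)) ⟩
  limit-weight n ⊛ α n ^ k ∎
  where
  open ≈-Reasoning
  s : ℤ
  s = (- 1ℤ) ℤ.^ (n ∸ 1)

α-power-below : ∀ f n j N → N < n → (f ⊛ α n ^ suc j) N ≡ 0ℤ
α-power-below f n j N N<n = trans
  (at (solve 4 (λ f x u a → f :* ((x :* u) :* a) := x :* (f :* u :* a)) ≈-refl f (qPow n) (I n ⊛ I n) (α n ^ j)) N)
  (qPow-⊛-below n (f ⊛ (I n ⊛ I n) ⊛ α n ^ j) N N<n)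

summands-agree : ∀ j N M → N ℕ.+ N ≤ M → ∀ {n} → n ∈ interval 1 M →
  (weight (interval 1 M) n ⊛ α n ^ suc j) N ≡ rhsTerm (suc j) n N
summands-agree j N M 2N≤M {n} n∈ with n ℕP.≤? N
... | yes n≤N = trans (subst (λ M′ → (weight (interval 1 M′) n ⊛ α n ^ suc j) N ≡ (limit-weight n ⊛ α n ^ suc j) N)
                             (ℕP.m+[n∸m]≡n n≤M)
                             (≈[]-⊛ (suc t) (α n ^ suc j) (weight-≈[]-limit n t 1≤n) N (s≤s N≤t)))
                      (sym (at (rhsTerm≈ (suc j) n) N))
  where
  1≤n : 1 ≤ n
  1≤n = proj₁ (∈-interval 1 M n∈)
  n≤M : n ≤ M
  n≤M = ℕP.≤-trans n≤N (ℕP.≤-trans (ℕP.m≤m+n N N) 2N≤M)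
  t : ℕ
  t = M ∸ n
  N≤t : N ≤ t
  N≤t = ℕP.≤-trans (ℕP.m+n≤o⇒m≤o∸n N 2N≤M) (ℕP.∸-monoʳ-≤ M n≤N)
... | no n≰N = trans (α-power-below (weight (interval 1 M) n) n j N N<n)
                     (sym (trans (at (rhsTerm≈ (suc j) n) N) (α-power-below (limit-weight n) n j N N<n)))
  where N<n = ℕP.≰⇒> n≰N

mainTheorem3 : (k : ℕ) → 1 ≤ k → (N : ℕ) →
    ∃[ M₀ ] ((M : ℕ) → M₀ ≤ M → lhsPartial k M N ≡ rhsPartial k M N)
mainTheorem3 (suc j) _ N = N ℕ.+ N , λ M 2N≤M → begin
  lhsPartial (suc j) M N
    ≡⟨ at (lhsPartial≈H j M) N ⟩
  H (suc j) (interval 1 M) N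
    ≡⟨ ΣL-coeff-cong (interval 1 M) N (summands-agree j N M 2N≤M) ⟩
  ΣL (map (rhsTerm (suc j)) (interval 1 M)) N
    ≡⟨ cong (λ ns → ΣL (map (rhsTerm (suc j)) ns) N) (sym (range-interval 1 M)) ⟩
  rhsPartial (suc j) M N ∎
  where open ≡-Reasoning
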